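{- $S^1_2$ proves: for every number $1^{(n)}$, $(\mathrm{Fact}(1^{(n)}))^2$ divides $\mathrm{Fact}(1^{(2n)})$.
   Context: $S^1_2$ is Buss's theory in language $\mathrm{PV}$ (function symbols for all polynomial-time algorithms) with $\Sigma^b_1$ polynomial induction. $1^{(n)}$ is the number whose binary expansion consists of $n$ ones (so $n$ is of logarithmic size). $\mathrm{Fact}$ is the $\mathrm{PV}$-symbol with $\mathrm{Fact}(0)=1$ and $\mathrm{Fact}(x)=\mathrm{Fact}(\lfloor x/2\rfloor)\cdot|x|$, where $|x|=\lceil\log_2(x+1)\rceil$; thus $\mathrm{Fact}(1^{(n)})=n!$. -}

module Defs where

open import Data.Nat using (ℕ; zero; suc; _+_; _*_; _^_; _≤_; _<_; z≤n; s≤s; ⌊_/2⌋)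
open import Data.Nat.Properties
open import Data.Nat.Solver using (module +-*-Solver)
open import Data.Fin using (Fin; zero; suc)
open import Data.Vec using (Vec; []; _∷_; lookup)
open import Data.Vec.Relation.Unary.All using (All; []; _∷_)
open import Data.Product using (Σ; _,_)
open import Relation.Binary.PropositionalEquality using (_≡_; refl; sym; trans; cong; cong₂)

-- binary length with fuel: lenF f x = |x| whenever x ≤ f
lenF : ℕ → ℕ → ℕ
lenF zero    _       = 0
lenF (suc f) zero    = 0
lenF (suc f) (suc x) = suc (lenF f ⌊ suc x /2⌋)

len : ℕ → ℕ
len x = lenF x x

smash : ℕ → ℕ → ℕ
smash x y = 2 ^ (len x * len y)

-- iteration along x, ⌊x/2⌋, ⌊x/4⌋, … (with fuel; exact when x ≤ fuel):
--   it g h x = g                        if x = 0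
--   it g h x = h (it g h ⌊x/2⌋) x        if x > 0
iterN : ℕ → (ℕ → ℕ → ℕ) → ℕ → ℕ → ℕ
iterN g h zero    _       = g
iterN g h (suc f) zero    = g
iterN g h (suc f) (suc x) = h (iterN g h f ⌊ suc x /2⌋) (suc x)

-- Part 2.  PV function symbols: Cobham's inductive description of the
-- polynomial-time functions.
data Fn : ℕ → Set where
  zero' : Fn 0
  succ' : Fn 1
  plus' : Fn 2
  times' : Fn 2
  len' : Fn 1
  half' : Fn 1
  smash' : Fn 2
  proj : ∀ {k} → Fin k → Fn k
  comp : ∀ {k m} → Fn m → Vec (Fn k) m → Fn k
  -- lrn g h b:  f(0, ȳ) = g(ȳ),  f(x, ȳ) = h(f(⌊x/2⌋, ȳ), x, ȳ) for x > 0,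
  -- subject to the bound f(x, ȳ) ≤ b(x, ȳ)  (see PV below)
  lrn : ∀ {m} → Fn m → Fn (suc (suc m)) → Fn (suc m) → Fn (suc m)

mutual
  ⟦_⟧ : ∀ {k} → Fn k → Vec ℕ k → ℕ
  ⟦ zero' ⟧ [] = 0
  ⟦ succ' ⟧ (x ∷ []) = suc x
  ⟦ plus' ⟧ (x ∷ y ∷ []) = x + y
  ⟦ times' ⟧ (x ∷ y ∷ []) = x * y
  ⟦ len' ⟧ (x ∷ []) = len x
  ⟦ half' ⟧ (x ∷ []) = ⌊ x /2⌋
  ⟦ smash' ⟧ (x ∷ y ∷ []) = smash x y
  ⟦ proj i ⟧ xs = lookup xs i
  ⟦ comp f gs ⟧ xs = ⟦ f ⟧ (⟦ gs ⟧* xs)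
  ⟦ lrn g h b ⟧ (x ∷ ys) = iterN (⟦ g ⟧ ys) (λ p x′ → ⟦ h ⟧ (p ∷ x′ ∷ ys)) x x

  ⟦_⟧* : ∀ {k m} → Vec (Fn k) m → Vec ℕ k → Vec ℕ m
  ⟦ [] ⟧* xs = []
  ⟦ g ∷ gs ⟧* xs = ⟦ g ⟧ xs ∷ ⟦ gs ⟧* xs

-- Well-formed (polynomially bounded) PV symbols: every limited recursion
-- on notation comes with a proof that its value is bounded by the
-- value of the bounding symbol (Cobham's condition).
data PV : ∀ {k} → Fn k → Set where
  zero' : PV zero'
  succ' : PV succ'
  plus' : PV plus'
  times' : PV times'
  len' : PV len'
  half' : PV half'
  smash' : PV smash'
  proj : ∀ {k} (i : Fin k) → PV (proj i)
  comp : ∀ {k m} {f : Fn m} {gs : Vec (Fn k) m} → PV f → All PV gs → PV (comp f gs)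
  lrn : ∀ {m} {g : Fn m} {h : Fn (suc (suc m))} {b : Fn (suc m)} →
        PV g → PV h → PV b →
        (∀ x ys → ⟦ lrn g h b ⟧ (x ∷ ys) ≤ ⟦ b ⟧ (x ∷ ys)) →
        PV (lrn g h b)

Sym : ℕ → Set
Sym k = Σ (Fn k) PV

-- Part 3.  Terms and formulas (de Bruijn variables; Tm n / Fm n have
-- n free variables).  Primitive predicates: = and ≤ (Buss's language).

data Tm (n : ℕ) : Set where
  var : Fin n → Tm n
  app : ∀ {k} → Sym k → Vec (Tm n) k → Tm n

infixr 2 _⇒_
infixr 3 _∧'_ _∨'_
infix 1 _⇔_
infix 9 _[_]
infix 4 _≐_ _≤'_
infixl 6 _⊕_
infixl 7 _⊗_
infixl 8 _♯_

data Fm (n : ℕ) : Set where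
  _≐_ : Tm n → Tm n → Fm n
  _≤'_ : Tm n → Tm n → Fm n
  ⊥' : Fm n
  _⇒_ : Fm n → Fm n → Fm n
  ∀' : Fm (suc n) → Fm n

¬' : ∀ {n} → Fm n → Fm n
¬' φ = φ ⇒ ⊥'

_∨'_ : ∀ {n} → Fm n → Fm n → Fm n
φ ∨' ψ = ¬' φ ⇒ ψ

_∧'_ : ∀ {n} → Fm n → Fm n → Fm n
φ ∧' ψ = ¬' (φ ⇒ ¬' ψ)

_⇔_ : ∀ {n} → Fm n → Fm n → Fm n
φ ⇔ ψ = (φ ⇒ ψ) ∧' (ψ ⇒ φ)

∃' : ∀ {n} → Fm (suc n) → Fm n
∃' φ = ¬' (∀' (¬' φ))

Sub : ℕ → ℕ → Set
Sub m n = Fin m → Tm n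

mutual
  substT : ∀ {m n} → Sub m n → Tm m → Tm n
  substT σ (var i) = σ i
  substT σ (app f ts) = app f (substTs σ ts)

  substTs : ∀ {m n k} → Sub m n → Vec (Tm m) k → Vec (Tm n) k
  substTs σ [] = []
  substTs σ (t ∷ ts) = substT σ t ∷ substTs σ ts

wkT : ∀ {n} → Tm n → Tm (suc n)
wkT = substT (λ i → var (suc i))

liftS : ∀ {m n} → Sub m n → Sub (suc m) (suc n)
liftS σ zero = var zero
liftS σ (suc i) = wkT (σ i)

substF : ∀ {m n} → Sub m n → Fm m → Fm n
substF σ (s ≐ t) = substT σ s ≐ substT σ t
substF σ (s ≤' t) = substT σ s ≤' substT σ t
substF σ ⊥' = ⊥'
substF σ (φ ⇒ ψ) = substF σ φ ⇒ substF σ ψ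
substF σ (∀' φ) = ∀' (substF (liftS σ) φ)

wkF : ∀ {n} → Fm n → Fm (suc n)
wkF = substF (λ i → var (suc i))

sub0 : ∀ {n} → Tm n → Sub (suc n) n
sub0 t zero = t
sub0 t (suc i) = var i

_[_] : ∀ {n} → Fm (suc n) → Tm n → Fm n
φ [ t ] = substF (sub0 t) φ

∀≤ : ∀ {n} → Tm n → Fm (suc n) → Fm n
∀≤ t φ = ∀' ((var zero ≤' wkT t) ⇒ φ)

∃≤ : ∀ {n} → Tm n → Fm (suc n) → Fm n
∃≤ t φ = ∃' ((var zero ≤' wkT t) ∧' φ)

Z : ∀ {n} → Tm n
Z = app (zero' , zero') []

S : ∀ {n} → Tm n → Tm n
S t = app (succ' , succ') (t ∷ [])

_⊕_ : ∀ {n} → Tm n → Tm n → Tm n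
s ⊕ t = app (plus' , plus') (s ∷ t ∷ [])

_⊗_ : ∀ {n} → Tm n → Tm n → Tm n
s ⊗ t = app (times' , times') (s ∷ t ∷ [])

∣_∣ : ∀ {n} → Tm n → Tm n
∣ t ∣ = app (len' , len') (t ∷ [])

½ : ∀ {n} → Tm n → Tm n
½ t = app (half' , half') (t ∷ [])

_♯_ : ∀ {n} → Tm n → Tm n → Tm n
s ♯ t = app (smash' , smash') (s ∷ t ∷ [])

data Open {n} : Fm n → Set where
  eq : ∀ s t → Open (s ≐ t)
  le : ∀ s t → Open (s ≤' t)
  bot : Open ⊥'
  imp : ∀ {φ ψ} → Open φ → Open ψ → Open (φ ⇒ ψ)

data Δb0 : ∀ {n} → Fm n → Set where
  eq : ∀ {n} (s t : Tm n) → Δb0 (s ≐ t)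
  le : ∀ {n} (s t : Tm n) → Δb0 (s ≤' t)
  bot : ∀ {n} → Δb0 {n} ⊥'
  imp : ∀ {n} {φ ψ : Fm n} → Δb0 φ → Δb0 ψ → Δb0 (φ ⇒ ψ)
  all|| : ∀ {n} (t : Tm n) {φ} → Δb0 φ → Δb0 (∀≤ ∣ t ∣ φ)
  ex|| : ∀ {n} (t : Tm n) {φ} → Δb0 φ → Δb0 (∃≤ ∣ t ∣ φ)

data Σb1 : ∀ {n} → Fm n → Set where
  base : ∀ {n} {φ : Fm n} → Δb0 φ → Σb1 φ
  and : ∀ {n} {φ ψ : Fm n} → Σb1 φ → Σb1 ψ → Σb1 (φ ∧' ψ)
  or : ∀ {n} {φ ψ : Fm n} → Σb1 φ → Σb1 ψ → Σb1 (φ ∨' ψ)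
  ex≤ : ∀ {n} (t : Tm n) {φ} → Σb1 φ → Σb1 (∃≤ t φ)
  all|| : ∀ {n} (t : Tm n) {φ} → Σb1 φ → Σb1 (∀≤ ∣ t ∣ φ)

-- Part 5.  The 32 BASIC axioms of Buss (Bounded Arithmetic, 1986),
-- as open formulas in the free variables a, b, c, d.

a b c d : Tm 4
a = var zero
b = var (suc zero)
c = var (suc (suc zero))
d = var (suc (suc (suc zero)))

𝟏 𝟐 : ∀ {n} → Tm n
𝟏 = S Z
𝟐 = S (S Z)

_≠_ : ∀ {n} → Tm n → Tm n → Fm n
s ≠ t = ¬' (s ≐ t)

infix 4 _≠_

data BASIC : Fm 4 → Set where
  B1 : BASIC (b ≤' a ⇒ b ≤' S a)
  B2 : BASIC (a ≠ S a)
  B3 : BASIC (Z ≤' a)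
  B4 : BASIC (((a ≤' b) ∧' (a ≠ b)) ⇔ (S a ≤' b))
  B5 : BASIC (a ≠ Z ⇒ (𝟐 ⊗ a) ≠ Z)
  B6 : BASIC ((b ≤' a) ∨' (a ≤' b))
  B7 : BASIC (((a ≤' b) ∧' (b ≤' a)) ⇒ a ≐ b)
  B8 : BASIC (((a ≤' b) ∧' (b ≤' c)) ⇒ a ≤' c)
  B9 : BASIC (∣ Z ∣ ≐ Z)
  B10 : BASIC (a ≠ Z ⇒ ((∣ 𝟐 ⊗ a ∣ ≐ S ∣ a ∣) ∧' (∣ S (𝟐 ⊗ a) ∣ ≐ S ∣ a ∣)))
  B11 : BASIC (∣ 𝟏 ∣ ≐ 𝟏)
  B12 : BASIC (a ≤' b ⇒ ∣ a ∣ ≤' ∣ b ∣)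
  B13 : BASIC (∣ a ♯ b ∣ ≐ S (∣ a ∣ ⊗ ∣ b ∣))
  B14 : BASIC (Z ♯ a ≐ 𝟏)
  B15 : BASIC (a ≠ Z ⇒ (((𝟏 ♯ (𝟐 ⊗ a)) ≐ 𝟐 ⊗ (𝟏 ♯ a)) ∧' ((𝟏 ♯ S (𝟐 ⊗ a)) ≐ 𝟐 ⊗ (𝟏 ♯ a))))
  B16 : BASIC (a ♯ b ≐ b ♯ a)
  B17 : BASIC (∣ a ∣ ≐ ∣ b ∣ ⇒ a ♯ c ≐ b ♯ c)
  B18 : BASIC (∣ a ∣ ≐ ∣ b ∣ ⊕ ∣ c ∣ ⇒ a ♯ d ≐ (b ♯ d) ⊗ (c ♯ d))
  B19 : BASIC (a ≤' a ⊕ b)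
  B20 : BASIC (((a ≤' b) ∧' (a ≠ b)) ⇒ ((S (𝟐 ⊗ a) ≤' 𝟐 ⊗ b) ∧' (S (𝟐 ⊗ a) ≠ 𝟐 ⊗ b)))
  B21 : BASIC (a ⊕ b ≐ b ⊕ a)
  B22 : BASIC (a ⊕ Z ≐ a)
  B23 : BASIC (a ⊕ S b ≐ S (a ⊕ b))
  B24 : BASIC ((a ⊕ b) ⊕ c ≐ a ⊕ (b ⊕ c))
  B25 : BASIC ((a ⊕ b ≤' a ⊕ c) ⇔ (b ≤' c))
  B26 : BASIC (a ⊗ Z ≐ Z)
  B27 : BASIC (a ⊗ S b ≐ (a ⊗ b) ⊕ a)
  B28 : BASIC (a ⊗ b ≐ b ⊗ a)
  B29 : BASIC (a ⊗ (b ⊕ c) ≐ (a ⊗ b) ⊕ (a ⊗ c))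
  B30 : BASIC (𝟏 ≤' a ⇒ ((a ⊗ b ≤' a ⊗ c) ⇔ (b ≤' c)))
  B31 : BASIC (a ≠ Z ⇒ ∣ a ∣ ≐ S ∣ ½ a ∣)
  B32 : BASIC ((a ≐ ½ b) ⇔ ((𝟐 ⊗ a ≐ b) ∨' (S (𝟐 ⊗ a) ≐ b)))

-- S¹₂⊢ φ  (φ : Fm n) : φ is derivable (free variables read universally).

apps : ∀ {n k m} (gs : Vec (Fn k) m) → All PV gs → Vec (Tm n) k → Vec (Tm n) m
apps [] [] ts = []
apps (g ∷ gs) (pg ∷ pgs) ts = app (g , pg) ts ∷ apps gs pgs ts

subHalf : ∀ {n} → Sub (suc n) (suc n)
subHalf zero = ½ (var zero)
subHalf (suc i) = var (suc i)

data S¹₂⊢_ : ∀ {n} → Fm n → Set where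
  ax-K : ∀ {n} {φ ψ : Fm n} → S¹₂⊢ (φ ⇒ ψ ⇒ φ)
  ax-S : ∀ {n} {φ ψ χ : Fm n} → S¹₂⊢ ((φ ⇒ ψ ⇒ χ) ⇒ (φ ⇒ ψ) ⇒ φ ⇒ χ)
  ax-DN : ∀ {n} {φ : Fm n} → S¹₂⊢ (¬' (¬' φ) ⇒ φ)
  mp : ∀ {n} {φ ψ : Fm n} → S¹₂⊢ (φ ⇒ ψ) → S¹₂⊢ φ → S¹₂⊢ ψ
  ax-∀E : ∀ {n} (φ : Fm (suc n)) (t : Tm n) → S¹₂⊢ (∀' φ ⇒ φ [ t ])
  gen : ∀ {n} {ψ : Fm n} {φ : Fm (suc n)} → S¹₂⊢ (wkF ψ ⇒ φ) → S¹₂⊢ (ψ ⇒ ∀' φ)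
  eq-refl : ∀ {n} (t : Tm n) → S¹₂⊢ (t ≐ t)
  eq-subst : ∀ {n} (φ : Fm (suc n)) (s t : Tm n) → S¹₂⊢ (s ≐ t ⇒ φ [ s ] ⇒ φ [ t ])
  basic : ∀ {n} {φ : Fm 4} → BASIC φ → (σ : Sub 4 n) → S¹₂⊢ substF σ φ
  def-proj : ∀ {n k} (i : Fin k) (ts : Vec (Tm n) k) →
             S¹₂⊢ (app (proj i , proj i) ts ≐ lookup ts i)
  def-comp : ∀ {n k m} {f : Fn m} {gs : Vec (Fn k) m} (pf : PV f) (pgs : All PV gs)
             (ts : Vec (Tm n) k) →
             S¹₂⊢ (app (comp f gs , comp pf pgs) ts ≐ app (f , pf) (apps gs pgs ts))
  def-lrn0 : ∀ {n m} {g : Fn m} {h : Fn (suc (suc m))} {bd : Fn (suc m)}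
             (pg : PV g) (ph : PV h) (pb : PV bd) bnd (ys : Vec (Tm n) m) →
             S¹₂⊢ (app (lrn g h bd , lrn pg ph pb bnd) (Z ∷ ys) ≐ app (g , pg) ys)
  def-lrn1 : ∀ {n m} {g : Fn m} {h : Fn (suc (suc m))} {bd : Fn (suc m)}
             (pg : PV g) (ph : PV h) (pb : PV bd) bnd (x : Tm n) (ys : Vec (Tm n) m) →
             S¹₂⊢ (x ≠ Z ⇒
                   app (lrn g h bd , lrn pg ph pb bnd) (x ∷ ys)
                     ≐ app (h , ph) (app (lrn g h bd , lrn pg ph pb bnd) (½ x ∷ ys) ∷ x ∷ ys))
  pind : ∀ {n} (φ : Fm (suc n)) → Σb1 φ →
         S¹₂⊢ ((φ [ Z ] ∧' ∀' (substF subHalf φ ⇒ φ))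
               ⇒ ∀' φ)

-- Part 7.  The PV symbol Fact:
--   Fact(0) = 1,  Fact(x) = Fact(⌊x/2⌋)·|x|  (x > 0),  bounded by x # x.

factG : Fn 0
factG = comp succ' (comp zero' [] ∷ [])

factH : Fn 2
factH = comp times' (proj zero ∷ comp len' (proj (suc zero) ∷ []) ∷ [])

factB : Fn 1
factB = comp smash' (proj zero ∷ proj zero ∷ [])

n<2^n : ∀ n → suc n ≤ 2 ^ n
n<2^n zero = s≤s z≤n
n<2^n (suc n) = ≤-trans (≤-reflexive (+-comm 1 (suc n)))
                 (≤-trans (+-mono-≤ (n<2^n n) (≤-trans (s≤s z≤n) (n<2^n n)))
                          (≤-reflexive (cong (2 ^ n +_) (sym (+-identityʳ (2 ^ n))))))

half≤ : ∀ x → ⌊ suc x /2⌋ ≤ x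
half≤ x = ≤-pred (⌊n/2⌋<n x)

lenF-stable : ∀ f g x → x ≤ f → x ≤ g → lenF f x ≡ lenF g x
lenF-stable zero zero zero _ _ = refl
lenF-stable zero (suc g) zero _ _ = refl
lenF-stable (suc f) zero zero _ _ = refl
lenF-stable (suc f) (suc g) zero _ _ = refl
lenF-stable (suc f) (suc g) (suc x) (s≤s p) (s≤s q) =
  cong suc (lenF-stable f g ⌊ suc x /2⌋ (≤-trans (half≤ x) p) (≤-trans (half≤ x) q))

sq-lemma : ∀ L → L * L + suc L ≤ suc L * suc L
sq-lemma L = ≤-trans (m≤m+n (L * L + suc L) L) (≤-reflexive (sqEq L))
  where
  sqEq : ∀ L → L * L + suc L + L ≡ suc L * suc L
  sqEq L = solve 1 (λ l → l :* l :+ (con 1 :+ l) :+ l := (con 1 :+ l) :* (con 1 :+ l)) refl L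
    where open +-*-Solver

factH′ : ℕ → ℕ → ℕ
factH′ p x = p * len x

factIt : ∀ f x → x ≤ f → iterN 1 factH′ f x ≤ 2 ^ (lenF f x * lenF f x)
factIt zero zero _ = ≤-refl
factIt (suc f) zero _ = ≤-refl
factIt (suc f) (suc x) (s≤s p) =
  ≤-trans (≤-reflexive (cong (iterN 1 factH′ f y *_) lenEq))
  (≤-trans (*-monoˡ-≤ (suc L) (factIt f y hy))
  (≤-trans (*-monoʳ-≤ (2 ^ (L * L)) (≤-trans (n≤1+n (suc L)) (n<2^n (suc L))))
  (≤-trans (≤-reflexive (sym (^-distribˡ-+-* 2 (L * L) (suc L))))
           (^-monoʳ-≤ 2 (sq-lemma L)))))
  where
  y = ⌊ suc x /2⌋
  hy : y ≤ f
  hy = ≤-trans (half≤ x) p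
  L = lenF f y
  lenEq : len (suc x) ≡ suc L
  lenEq = lenF-stable (suc x) (suc f) (suc x) ≤-refl (s≤s p)

factBound : ∀ x (ys : Vec ℕ 0) → ⟦ lrn factG factH factB ⟧ (x ∷ ys) ≤ ⟦ factB ⟧ (x ∷ ys)
factBound x [] = factIt x x ≤-refl

Fact : Sym 1
Fact = lrn factG factH factB ,
       lrn (comp succ' (comp zero' [] ∷ []))
           (comp times' (proj zero ∷ comp len' (proj (suc zero) ∷ []) ∷ []))
           (comp smash' (proj zero ∷ proj zero ∷ []))
           factBound

F : ∀ {n} → Tm n → Tm n
F t = app Fact (t ∷ [])

-- Here x + 1 = 1 # x (= 2^|x|) says x = 1^(n)
-- with n = |x|, and then x·x + x + x = (x+1)² − 1 = 1^(2n).

ones2 : ∀ {n} → Tm n → Tm n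
ones2 x = (x ⊗ x) ⊕ x ⊕ x

IsOnes : ∀ {n} → Tm n → Fm n
IsOnes x = x ⊕ 𝟏 ≐ 𝟏 ♯ x

Divides : ∀ {n} → Tm n → Tm n → Fm n
Divides s t = ∃≤ t ((wkT s ⊗ var zero) ≐ wkT t)

FactSquareDiv : Fm 0
FactSquareDiv = ∀' (IsOnes x ⇒ Divides (F x ⊗ F x) (F (ones2 x)))
  where
  x : Tm 1
  x = var zero

{-# OPTIONS --safe #-}
module Submission where

-- Since Fact x = ∣x∣!, the theorem is the case z = v = x of Binom z v: ∣z∣!·∣v∣! divides (∣z∣ + ∣v∣)!,
-- the factorial of ∣z∣ + ∣v∣ being Fact (appendOnes v z), where appendOnes v z is z followed by ∣v∣
-- binary ones; for x = 1^(n), appendOnes x x = x·x + x + x.  Binom follows from Pascal's rule: if q and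
-- r are the quotients for (½z, v) and (z, ½v), then q + r is one for (z, v), since with m = ∣z∣ and
-- k = ∣v∣ we get m!k!·q = m·(m+k−1)! and m!k!·r = k·(m+k−1)!.  This is a double induction on notation,
-- and S¹₂ only allows Σ^b_1 induction formulas.  So the outer induction on v, for a fixed bound u,
-- quantifies over the lengths j ≤ ∣u∣ (a sharply bounded quantifier) rather than over all z ≤ u; this
-- loses nothing because Fact, hence Binom, depends only on the lengths of its arguments, and every
-- j ≤ ∣u∣ is the length of some z ≤ u.

open import Defs hiding (a; b; c; d)
open import Data.Nat using (ℕ; zero; suc; _+_; _*_; _^_; _≤_; s≤s; ⌊_/2⌋)
open import Data.Nat.Properties
  using (≤-trans; ≤-reflexive; ≤-refl; ≤-pred; n≤1+n; ⌊n/2⌋<n; *-identityʳ; *-identityˡ; +-mono-≤; +-suc;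
         module ≤-Reasoning)
open import Data.Nat.Solver using (module +-*-Solver)
open import Data.Fin using (Fin; zero; suc)
open import Data.Vec using (Vec; []; _∷_; lookup)
open import Data.Vec.Relation.Unary.All using (All; []; _∷_)
open import Data.List using (List; []; _∷_; map)
open import Data.Product using (_,_)
open import Relation.Binary.PropositionalEquality using (_≡_; refl; sym; trans; cong; cong₂; subst; subst₂)

private
  variable
    j k l m n : ℕ
    Γ : List (Fm n)
    A B C D E G H I φ : Fm n
    p q r s s' t t' u v w z : Tm n
    σ τ : Sub m n

-- appendOnes v z is z followed by ∣v∣ binary ones, that is (z + 1)·2^∣v∣ − 1.
appendOnesH : Fn 3
appendOnesH = comp succ' (comp plus' (proj zero ∷ proj zero ∷ []) ∷ [])

appendOnesB : Fn 2
appendOnesB = comp times' (comp succ' (proj (suc zero) ∷ []) ∷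
                           comp smash' (comp succ' (comp zero' [] ∷ []) ∷ proj zero ∷ []) ∷ [])

appendOnesH-PV : PV appendOnesH
appendOnesH-PV = comp succ' (comp plus' (proj zero ∷ proj zero ∷ []) ∷ [])

appendOnesB-PV : PV appendOnesB
appendOnesB-PV = comp times' (comp succ' (proj (suc zero) ∷ []) ∷
                              comp smash' (comp succ' (comp zero' [] ∷ []) ∷ proj zero ∷ []) ∷ [])

appendOnes-iterN-bound : ∀ z f x → x ≤ f →
                         suc (iterN z (λ p _ → suc (p + p)) f x) ≤ suc z * 2 ^ lenF f x
appendOnes-iterN-bound z zero _ _ = ≤-reflexive (sym (*-identityʳ (suc z)))
appendOnes-iterN-bound z (suc f) zero _ = ≤-reflexive (sym (*-identityʳ (suc z)))
appendOnes-iterN-bound z (suc f) (suc x) (s≤s x≤f) = begin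
  suc (suc (R + R))              ≡⟨ cong suc (sym (+-suc R R)) ⟩
  suc R + suc R                  ≤⟨ +-mono-≤ ih ih ⟩
  suc z * 2 ^ L + suc z * 2 ^ L  ≡⟨ double (suc z) (2 ^ L) ⟩
  suc z * 2 ^ suc L              ∎
  where
  open ≤-Reasoning
  y R L : ℕ
  y = ⌊ suc x /2⌋
  R = iterN z (λ p _ → suc (p + p)) f y
  L = lenF f y
  ih : suc R ≤ suc z * 2 ^ L
  ih = appendOnes-iterN-bound z f y (≤-trans (≤-pred (⌊n/2⌋<n x)) x≤f)
  double : ∀ a b → a * b + a * b ≡ a * (2 * b)
  double = solve 2 (λ a b → a :* b :+ a :* b := a :* (con 2 :* b)) refl
    where open +-*-Solver

appendOnes-bound : ∀ x ys →
                   ⟦ lrn (proj zero) appendOnesH appendOnesB ⟧ (x ∷ ys) ≤ ⟦ appendOnesB ⟧ (x ∷ ys)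
appendOnes-bound x (z ∷ []) = begin
  iterN z (λ p _ → suc (p + p)) x x        ≤⟨ n≤1+n _ ⟩
  suc (iterN z (λ p _ → suc (p + p)) x x)  ≤⟨ appendOnes-iterN-bound z x x ≤-refl ⟩
  suc z * 2 ^ len x                        ≡⟨ cong (λ e → suc z * 2 ^ e) (sym (*-identityˡ (len x))) ⟩
  suc z * 2 ^ (1 * len x)                  ∎
  where open ≤-Reasoning

AppendOnes : Sym 2
AppendOnes = lrn (proj zero) appendOnesH appendOnesB ,
             lrn (proj zero) appendOnesH-PV appendOnesB-PV appendOnes-bound

appendOnes : Tm n → Tm n → Tm n
appendOnes v z = app AppendOnes (v ∷ z ∷ [])

_≗ₛ_ : Sub m n → Sub m n → Set
σ ≗ₛ τ = ∀ i → σ i ≡ τ i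

_∘ₛ_ : Sub n k → Sub m n → Sub m k
(σ ∘ₛ τ) i = substT σ (τ i)

wk : Sub n (suc n)
wk i = var (suc i)

infixr 5 _∷ₛ_

ε : Sub 0 n
ε ()

_∷ₛ_ : Tm n → Sub m n → Sub (suc m) n
(t ∷ₛ σ) zero = t
(t ∷ₛ σ) (suc i) = σ i

mutual
  substT-cong : σ ≗ₛ τ → ∀ t → substT σ t ≡ substT τ t
  substT-cong e (var i) = e i
  substT-cong e (app f ts) = cong (app f) (substTs-cong e ts)

  substTs-cong : σ ≗ₛ τ → (ts : Vec (Tm m) k) → substTs σ ts ≡ substTs τ ts
  substTs-cong e [] = refl
  substTs-cong e (t ∷ ts) = cong₂ _∷_ (substT-cong e t) (substTs-cong e ts)

mutual
  substT-∘ : (σ : Sub n k) (τ : Sub m n) (t : Tm m) → substT σ (substT τ t) ≡ substT (σ ∘ₛ τ) t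
  substT-∘ σ τ (var i) = refl
  substT-∘ σ τ (app f ts) = cong (app f) (substTs-∘ σ τ ts)

  substTs-∘ : (σ : Sub n k) (τ : Sub m n) (ts : Vec (Tm m) j) →
              substTs σ (substTs τ ts) ≡ substTs (σ ∘ₛ τ) ts
  substTs-∘ σ τ [] = refl
  substTs-∘ σ τ (t ∷ ts) = cong₂ _∷_ (substT-∘ σ τ t) (substTs-∘ σ τ ts)

mutual
  substT-id : (t : Tm n) → substT var t ≡ t
  substT-id (var i) = refl
  substT-id (app f ts) = cong (app f) (substTs-id ts)

  substTs-id : (ts : Vec (Tm n) k) → substTs var ts ≡ ts
  substTs-id [] = refl
  substTs-id (t ∷ ts) = cong₂ _∷_ (substT-id t) (substTs-id ts)

liftS-cong : σ ≗ₛ τ → liftS σ ≗ₛ liftS τ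
liftS-cong e zero = refl
liftS-cong e (suc i) = cong wkT (e i)

liftS-wkT : (σ : Sub m n) (t : Tm m) → substT (liftS σ) (wkT t) ≡ wkT (substT σ t)
liftS-wkT σ t = trans (substT-∘ (liftS σ) wk t) (sym (substT-∘ wk σ t))

liftS-∘ : (σ : Sub n k) (τ : Sub m n) → (liftS σ ∘ₛ liftS τ) ≗ₛ liftS (σ ∘ₛ τ)
liftS-∘ σ τ zero = refl
liftS-∘ σ τ (suc i) = liftS-wkT σ (τ i)

liftS-id : liftS (var {n}) ≗ₛ var
liftS-id zero = refl
liftS-id (suc i) = refl

sub0-wkT : (s t : Tm n) → substT (sub0 s) (wkT t) ≡ t
sub0-wkT s t = trans (substT-∘ (sub0 s) wk t) (substT-id t)

substF-cong : σ ≗ₛ τ → ∀ φ → substF σ φ ≡ substF τ φ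
substF-cong e (s ≐ t) = cong₂ _≐_ (substT-cong e s) (substT-cong e t)
substF-cong e (s ≤' t) = cong₂ _≤'_ (substT-cong e s) (substT-cong e t)
substF-cong e ⊥' = refl
substF-cong e (φ ⇒ ψ) = cong₂ _⇒_ (substF-cong e φ) (substF-cong e ψ)
substF-cong e (∀' φ) = cong ∀' (substF-cong (liftS-cong e) φ)

substF-∘ : (σ : Sub n k) (τ : Sub m n) (φ : Fm m) → substF σ (substF τ φ) ≡ substF (σ ∘ₛ τ) φ
substF-∘ σ τ (s ≐ t) = cong₂ _≐_ (substT-∘ σ τ s) (substT-∘ σ τ t)
substF-∘ σ τ (s ≤' t) = cong₂ _≤'_ (substT-∘ σ τ s) (substT-∘ σ τ t)
substF-∘ σ τ ⊥' = refl
substF-∘ σ τ (φ ⇒ ψ) = cong₂ _⇒_ (substF-∘ σ τ φ) (substF-∘ σ τ ψ)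
substF-∘ σ τ (∀' φ) = cong ∀' (trans (substF-∘ (liftS σ) (liftS τ) φ) (substF-cong (liftS-∘ σ τ) φ))

substF-id : (φ : Fm n) → substF var φ ≡ φ
substF-id (s ≐ t) = cong₂ _≐_ (substT-id s) (substT-id t)
substF-id (s ≤' t) = cong₂ _≤'_ (substT-id s) (substT-id t)
substF-id ⊥' = refl
substF-id (φ ⇒ ψ) = cong₂ _⇒_ (substF-id φ) (substF-id ψ)
substF-id (∀' φ) = cong ∀' (trans (substF-cong liftS-id φ) (substF-id φ))

substF-∘-square : (σ : Sub n k) (τ : Sub m n) (σ′ : Sub l k) (τ′ : Sub m l) →
                  (σ ∘ₛ τ) ≗ₛ (σ′ ∘ₛ τ′) → ∀ φ → substF σ (substF τ φ) ≡ substF σ′ (substF τ′ φ)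
substF-∘-square σ τ σ′ τ′ e φ =
  trans (substF-∘ σ τ φ) (trans (substF-cong e φ) (sym (substF-∘ σ′ τ′ φ)))

substF-[] : (σ : Sub m n) (t : Tm m) (φ : Fm (suc m)) →
            substF σ (φ [ t ]) ≡ substF (liftS σ) φ [ substT σ t ]
substF-[] σ t = substF-∘-square σ (sub0 t) (sub0 (substT σ t)) (liftS σ) square
  where
  square : (σ ∘ₛ sub0 t) ≗ₛ (sub0 (substT σ t) ∘ₛ liftS σ)
  square zero = refl
  square (suc i) = sym (sub0-wkT (substT σ t) (σ i))

substF-subHalf : (σ : Sub m n) (φ : Fm (suc m)) →
                 substF (liftS σ) (substF subHalf φ) ≡ substF subHalf (substF (liftS σ) φ)
substF-subHalf σ = substF-∘-square (liftS σ) subHalf subHalf (liftS σ) square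
  where
  square : (liftS σ ∘ₛ subHalf) ≗ₛ (subHalf ∘ₛ liftS σ)
  square zero = refl
  square (suc i) = sym (substT-∘ subHalf wk (σ i))

liftS-wkF : (σ : Sub m n) (ψ : Fm m) → substF (liftS σ) (wkF ψ) ≡ wkF (substF σ ψ)
liftS-wkF σ = substF-∘-square (liftS σ) wk wk σ (λ i → refl)

wkF-[var0] : (φ : Fm (suc n)) → substF (liftS wk) φ [ var zero ] ≡ φ
wkF-[var0] φ = trans (substF-∘ (sub0 (var zero)) (liftS wk) φ) (trans (substF-cong e φ) (substF-id φ))
  where
  e : (sub0 (var zero) ∘ₛ liftS wk) ≗ₛ var
  e zero = refl
  e (suc i) = refl

Δb0-substF : Δb0 φ → (σ : Sub m n) → Δb0 (substF σ φ)
Δb0-substF (eq s t) σ = eq _ _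
Δb0-substF (le s t) σ = le _ _
Δb0-substF bot σ = bot
Δb0-substF (imp p q) σ = imp (Δb0-substF p σ) (Δb0-substF q σ)
Δb0-substF (all|| t {φ} p) σ =
  subst (λ u → Δb0 (∀' ((var zero ≤' ∣ u ∣) ⇒ substF (liftS σ) φ))) (sym (liftS-wkT σ t))
        (all|| (substT σ t) (Δb0-substF p (liftS σ)))
Δb0-substF (ex|| t {φ} p) σ =
  subst (λ u → Δb0 (∃' ((var zero ≤' ∣ u ∣) ∧' substF (liftS σ) φ))) (sym (liftS-wkT σ t))
        (ex|| (substT σ t) (Δb0-substF p (liftS σ)))

Σb1-substF : Σb1 φ → (σ : Sub m n) → Σb1 (substF σ φ)
Σb1-substF (base p) σ = base (Δb0-substF p σ)
Σb1-substF (and p q) σ = and (Σb1-substF p σ) (Σb1-substF q σ)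
Σb1-substF (or p q) σ = or (Σb1-substF p σ) (Σb1-substF q σ)
Σb1-substF (ex≤ t {φ} p) σ =
  subst (λ u → Σb1 (∃' ((var zero ≤' u) ∧' substF (liftS σ) φ))) (sym (liftS-wkT σ t))
        (ex≤ (substT σ t) (Σb1-substF p (liftS σ)))
Σb1-substF (all|| t {φ} p) σ =
  subst (λ u → Σb1 (∀' ((var zero ≤' ∣ u ∣) ⇒ substF (liftS σ) φ))) (sym (liftS-wkT σ t))
        (all|| (substT σ t) (Σb1-substF p (liftS σ)))

substT-lookup : (σ : Sub m n) (ts : Vec (Tm m) k) (i : Fin k) →
                substT σ (lookup ts i) ≡ lookup (substTs σ ts) i
substT-lookup σ (t ∷ ts) zero = refl
substT-lookup σ (t ∷ ts) (suc i) = substT-lookup σ ts i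

substTs-apps : (σ : Sub m n) (gs : Vec (Fn k) j) (pgs : All PV gs) (ts : Vec (Tm m) k) →
               substTs σ (apps gs pgs ts) ≡ apps gs pgs (substTs σ ts)
substTs-apps σ [] [] ts = refl
substTs-apps σ (g ∷ gs) (pg ∷ pgs) ts =
  cong (app (g , pg) (substTs σ ts) ∷_) (substTs-apps σ gs pgs ts)

⊢-substF : S¹₂⊢ φ → (σ : Sub m n) → S¹₂⊢ substF σ φ
⊢-substF ax-K σ = ax-K
⊢-substF ax-S σ = ax-S
⊢-substF ax-DN σ = ax-DN
⊢-substF (mp p q) σ = mp (⊢-substF p σ) (⊢-substF q σ)
⊢-substF (ax-∀E φ t) σ =
  subst (λ X → S¹₂⊢ (∀' (substF (liftS σ) φ) ⇒ X)) (sym (substF-[] σ t φ))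
        (ax-∀E (substF (liftS σ) φ) (substT σ t))
⊢-substF (gen {ψ = ψ} {φ = φ} p) σ =
  gen (subst (λ X → S¹₂⊢ (X ⇒ substF (liftS σ) φ)) (liftS-wkF σ ψ) (⊢-substF p (liftS σ)))
⊢-substF (eq-refl t) σ = eq-refl _
⊢-substF (eq-subst φ s t) σ =
  subst₂ (λ X Y → S¹₂⊢ (substT σ s ≐ substT σ t ⇒ X ⇒ Y))
         (sym (substF-[] σ s φ)) (sym (substF-[] σ t φ))
         (eq-subst (substF (liftS σ) φ) (substT σ s) (substT σ t))
⊢-substF (basic {φ = φ} B τ) σ = subst S¹₂⊢_ (sym (substF-∘ σ τ φ)) (basic B (σ ∘ₛ τ))
⊢-substF (def-proj i ts) σ =
  subst (λ X → S¹₂⊢ (app (proj i , proj i) (substTs σ ts) ≐ X)) (sym (substT-lookup σ ts i))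
        (def-proj i (substTs σ ts))
⊢-substF (def-comp {gs = gs} pf pgs ts) σ =
  subst (λ X → S¹₂⊢ (app (_ , comp pf pgs) (substTs σ ts) ≐ app (_ , pf) X))
        (sym (substTs-apps σ gs pgs ts))
        (def-comp pf pgs (substTs σ ts))
⊢-substF (def-lrn0 pg ph pb bnd ys) σ = def-lrn0 pg ph pb bnd (substTs σ ys)
⊢-substF (def-lrn1 pg ph pb bnd x ys) σ = def-lrn1 pg ph pb bnd (substT σ x) (substTs σ ys)
⊢-substF (pind φ s) σ =
  subst₂ (λ X Y → S¹₂⊢ ((X ∧' ∀' (Y ⇒ substF (liftS σ) φ)) ⇒ ∀' (substF (liftS σ) φ)))
         (sym (substF-[] σ Z φ)) (sym (substF-subHalf σ φ))
         (pind (substF (liftS σ) φ) (Σb1-substF s (liftS σ)))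

infixl 4 _·_

_⇒*_ : List (Fm n) → Fm n → Fm n
[] ⇒* φ = φ
(A ∷ Γ) ⇒* φ = Γ ⇒* (A ⇒ φ)

-- The head of Γ is the innermost antecedent, so discharging it (ƛ) costs nothing.
record _⊩_ {n} (Γ : List (Fm n)) (φ : Fm n) : Set where
  constructor ⟨_⟩
  field prf : S¹₂⊢ (Γ ⇒* φ)
open _⊩_ public

⇒-refl : S¹₂⊢ (φ ⇒ φ)
⇒-refl {φ = φ} = mp (mp ax-S ax-K) (ax-K {ψ = φ})

⇒*-const : (Γ : List (Fm n)) → S¹₂⊢ φ → S¹₂⊢ (Γ ⇒* φ)
⇒*-const [] p = p
⇒*-const (A ∷ Γ) p = ⇒*-const Γ (mp ax-K p)

⇒*-mp : (Γ : List (Fm n)) → S¹₂⊢ (Γ ⇒* (A ⇒ B)) → S¹₂⊢ (Γ ⇒* A) → S¹₂⊢ (Γ ⇒* B)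
⇒*-mp [] f x = mp f x
⇒*-mp (C ∷ Γ) f x = ⇒*-mp Γ (⇒*-mp Γ (⇒*-const Γ ax-S) f) x

thm : S¹₂⊢ φ → Γ ⊩ φ
thm {Γ = Γ} p = ⟨ ⇒*-const Γ p ⟩

closed : [] ⊩ φ → S¹₂⊢ φ
closed = prf

inst : S¹₂⊢ φ → (σ : Sub m n) → Γ ⊩ substF σ φ
inst p σ = thm (⊢-substF p σ)

_·_ : Γ ⊩ (A ⇒ B) → Γ ⊩ A → Γ ⊩ B
_·_ {Γ = Γ} f x = ⟨ ⇒*-mp Γ (prf f) (prf x) ⟩

ƛ : (A ∷ Γ) ⊩ B → Γ ⊩ (A ⇒ B)
ƛ p = ⟨ prf p ⟩

unƛ : Γ ⊩ (A ⇒ B) → (A ∷ Γ) ⊩ B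
unƛ p = ⟨ prf p ⟩

↑ : Γ ⊩ φ → (A ∷ Γ) ⊩ φ
↑ p = unƛ (thm ax-K · p)

h0 : (A ∷ Γ) ⊩ A
h0 {Γ = Γ} = ⟨ ⇒*-const Γ ⇒-refl ⟩
h1 : (B ∷ A ∷ Γ) ⊩ A
h1 = ↑ h0
h2 : (C ∷ B ∷ A ∷ Γ) ⊩ A
h2 = ↑ h1
h3 : (D ∷ C ∷ B ∷ A ∷ Γ) ⊩ A
h3 = ↑ h2
h4 : (E ∷ D ∷ C ∷ B ∷ A ∷ Γ) ⊩ A
h4 = ↑ h3
h5 : (G ∷ E ∷ D ∷ C ∷ B ∷ A ∷ Γ) ⊩ A
h5 = ↑ h4
h6 : (H ∷ G ∷ E ∷ D ∷ C ∷ B ∷ A ∷ Γ) ⊩ A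
h6 = ↑ h5
h7 : (I ∷ H ∷ G ∷ E ∷ D ∷ C ∷ B ∷ A ∷ Γ) ⊩ A
h7 = ↑ h6

dne : Γ ⊩ ¬' (¬' A) → Γ ⊩ A
dne p = thm ax-DN · p

efq : Γ ⊩ ⊥' → Γ ⊩ A
efq p = dne (ƛ (↑ p))

absurd : Γ ⊩ A → Γ ⊩ ¬' A → Γ ⊩ C
absurd a na = efq (na · a)

∧I : Γ ⊩ A → Γ ⊩ B → Γ ⊩ (A ∧' B)
∧I a b = ƛ (h0 · ↑ a · ↑ b)

∧E₁ : Γ ⊩ (A ∧' B) → Γ ⊩ A
∧E₁ p = dne (ƛ (↑ p · ƛ (efq (h1 · h0))))

∧E₂ : Γ ⊩ (A ∧' B) → Γ ⊩ B
∧E₂ p = dne (ƛ (↑ p · ƛ h1))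

∨I₂ : Γ ⊩ B → Γ ⊩ (A ∨' B)
∨I₂ b = ƛ (↑ b)

∨E : Γ ⊩ (A ∨' B) → Γ ⊩ (A ⇒ C) → Γ ⊩ (B ⇒ C) → Γ ⊩ C
∨E ab fa fb = dne (ƛ (h0 · (↑ fb · (↑ ab · ƛ (h1 · (↑ (↑ fa) · h0))))))

-- ¬' A ∨' A unfolds to the double-negation axiom.
cases : (A : Fm n) → Γ ⊩ (A ⇒ C) → Γ ⊩ (¬' A ⇒ C) → Γ ⊩ C
cases A fa fn = ∨E {A = ¬' A} {B = A} (thm ax-DN) fn fa

∀E : Γ ⊩ ∀' φ → (t : Tm n) → Γ ⊩ (φ [ t ])
∀E {φ = φ} p t = thm (ax-∀E φ t) · p

∀-pull : S¹₂⊢ (∀' (wkF A ⇒ φ) ⇒ (A ⇒ ∀' φ))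
∀-pull {A = A} {φ = φ} = closed (ƛ (ƛ (thm (gen instance-at-var0) · ∧I h1 h0)))
  where
  instance-at-var0 : S¹₂⊢ (wkF (∀' (wkF A ⇒ φ) ∧' A) ⇒ φ)
  instance-at-var0 = closed (ƛ (subst ((wkF (∀' (wkF A ⇒ φ) ∧' A) ∷ []) ⊩_) (wkF-[var0] (wkF A ⇒ φ))
                                      (∀E (∧E₁ h0) (var zero))
                                · ∧E₂ h0))

-- gen only generalises under an antecedent; for Γ = [] we use ⊥' ⇒ ⊥'.
∀I : map wkF Γ ⊩ φ → Γ ⊩ ∀' φ
∀I {Γ = []} p = ⟨ mp (gen {ψ = ⊥' ⇒ ⊥'} (mp ax-K (prf p))) ⇒-refl ⟩
∀I {Γ = A ∷ Γ} p = ⟨ prf (thm ∀-pull · ∀I {Γ = Γ} ⟨ prf p ⟩) ⟩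

∀-open : S¹₂⊢ ∀' φ → S¹₂⊢ φ
∀-open {φ = φ} p = subst S¹₂⊢_ (wkF-[var0] φ) (closed (∀E (inst p wk) (var zero)))

∃I : (t : Tm n) → Γ ⊩ (φ [ t ]) → Γ ⊩ ∃' φ
∃I t p = ƛ (∀E h0 t · ↑ p)

∃E : Γ ⊩ ∃' φ → (φ ∷ map wkF Γ) ⊩ wkF C → Γ ⊩ C
∃E {Γ = Γ} e b = dne (ƛ (↑ e · ∀I {Γ = _ ∷ Γ} (ƛ (h1 · (↑ (↑ (ƛ b)) · h0)))))

∀≤I : ((var zero ≤' wkT t) ∷ map wkF Γ) ⊩ φ → Γ ⊩ ∀≤ t φ
∀≤I b = ∀I (ƛ b)

∀≤E : Γ ⊩ ∀≤ t φ → (s : Tm n) → Γ ⊩ (s ≤' t) → Γ ⊩ (φ [ s ])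
∀≤E {Γ = Γ} {t = t} p s lp = ∀E p s · subst (λ X → Γ ⊩ (s ≤' X)) (sym (sub0-wkT s t)) lp

∃≤I : (s : Tm n) → Γ ⊩ (s ≤' t) → Γ ⊩ (φ [ s ]) → Γ ⊩ ∃≤ t φ
∃≤I {Γ = Γ} {t = t} s lp p = ∃I s (∧I (subst (λ X → Γ ⊩ (s ≤' X)) (sym (sub0-wkT s t)) lp) p)

∃≤E : Γ ⊩ ∃≤ t φ →
      (φ ∷ (var zero ≤' wkT t) ∷ map wkF Γ) ⊩ wkF C → Γ ⊩ C
∃≤E e b = ∃E e (↑ (ƛ (ƛ b)) · ∧E₁ h0 · ∧E₂ h0)

induction : (φ : Fm (suc n)) → Σb1 φ → Γ ⊩ (φ [ Z ]) →
            map wkF Γ ⊩ (substF subHalf φ ⇒ φ) → Γ ⊩ ∀' φ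
induction φ cls start step = thm (pind φ cls) · ∧I start (∀I step)

pind-open : (φ : Fm (suc n)) → Σb1 φ → [] ⊩ (φ [ Z ]) → (substF subHalf φ ∷ []) ⊩ φ → S¹₂⊢ φ
pind-open φ cls start step = ∀-open (prf (induction φ cls start (ƛ step)))

Thm : (n : ℕ) → Fm n → Set
Thm n φ = S¹₂⊢ φ

x0 : Tm (suc n)
x0 = var zero
x1 : Tm (suc (suc n))
x1 = var (suc zero)
x2 : Tm (suc (suc (suc n)))
x2 = var (suc (suc zero))
x3 : Tm (suc (suc (suc (suc n))))
x3 = var (suc (suc (suc zero)))

rfl : Γ ⊩ (t ≐ t)
rfl {t = t} = thm (eq-refl t)

leibniz : (φ : Fm (suc n)) → Γ ⊩ (s ≐ t) → Γ ⊩ (φ [ s ]) → Γ ⊩ (φ [ t ])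
leibniz {s = s} {t = t} φ e p = thm (eq-subst φ s t) · e · p

symm : Γ ⊩ (s ≐ t) → Γ ⊩ (t ≐ s)
symm {s = s} {t = t} p = inst symm₀ (s ∷ₛ t ∷ₛ ε) · p
  where
  symm₀ : Thm 2 (x0 ≐ x1 ⇒ x1 ≐ x0)
  symm₀ = closed (ƛ (leibniz (x0 ≐ x1) h0 rfl))

tr : Γ ⊩ (s ≐ t) → Γ ⊩ (t ≐ u) → Γ ⊩ (s ≐ u)
tr {s = s} {t = t} {u = u} p q = inst trans₀ (s ∷ₛ t ∷ₛ u ∷ₛ ε) · p · q
  where
  trans₀ : Thm 3 (x0 ≐ x1 ⇒ x1 ≐ x2 ⇒ x0 ≐ x2)
  trans₀ = closed (ƛ (ƛ (leibniz (x1 ≐ x0) h0 h1)))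

pind-≢Z : (φ : Fm (suc n)) → Σb1 φ → [] ⊩ (φ [ Z ]) →
          ((x0 ≠ Z) ∷ substF subHalf φ ∷ []) ⊩ φ → S¹₂⊢ φ
pind-≢Z {n = n} φ cls start step = pind-open φ cls start (cases (x0 ≐ Z) (ƛ at-zero) (ƛ step))
  where
  Hyps : List (Fm (suc n))
  Hyps = (x0 ≐ Z) ∷ substF subHalf φ ∷ []
  at-zero : Hyps ⊩ φ
  at-zero = subst (Hyps ⊩_) (wkF-[var0] φ)
              (leibniz (substF (liftS wk) φ) (symm h0)
                       (subst (Hyps ⊩_) (substF-[] wk Z φ) (inst (closed start) wk)))

infixr 2 _≐⟨_⟩_
infix 3 _∎

_≐⟨_⟩_ : (x : Tm n) → Γ ⊩ (x ≐ s) → Γ ⊩ (s ≐ t) → Γ ⊩ (x ≐ t)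
x ≐⟨ p ⟩ q = tr p q

_∎ : (x : Tm n) → Γ ⊩ (x ≐ x)
x ∎ = rfl

≐-context : (C : Tm (suc n)) → Γ ⊩ (s ≐ t) →
            Γ ⊩ (substT (sub0 s) C ≐ substT (sub0 t) C)
≐-context {Γ = Γ} {s = s} {t = t} C e =
  subst (λ X → Γ ⊩ (X ≐ substT (sub0 t) C)) (sub0-wkT t (substT (sub0 s) C))
    (leibniz (wkT (substT (sub0 s) C) ≐ C) e
      (subst (λ X → Γ ⊩ (X ≐ substT (sub0 s) C)) (sym (sub0-wkT s (substT (sub0 s) C))) rfl))

cong1 : (f : Sym 1) → Γ ⊩ (s ≐ t) → Γ ⊩ (app f (s ∷ []) ≐ app f (t ∷ []))
cong1 {s = s} {t = t} f p = inst cong1₀ (s ∷ₛ t ∷ₛ ε) · p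
  where
  cong1₀ : Thm 2 (x0 ≐ x1 ⇒ app f (x0 ∷ []) ≐ app f (x1 ∷ []))
  cong1₀ = closed (ƛ (≐-context (app f (x0 ∷ [])) h0))

cong2 : (f : Sym 2) → Γ ⊩ (s ≐ s') → Γ ⊩ (t ≐ t') →
        Γ ⊩ (app f (s ∷ t ∷ []) ≐ app f (s' ∷ t' ∷ []))
cong2 {s = s} {s' = s'} {t = t} {t' = t'} f p q = inst cong2₀ (s ∷ₛ s' ∷ₛ t ∷ₛ t' ∷ₛ ε) · p · q
  where
  cong2₀ : Thm 4 (x0 ≐ x1 ⇒ x2 ≐ x3 ⇒ app f (x0 ∷ x2 ∷ []) ≐ app f (x1 ∷ x3 ∷ []))
  cong2₀ = closed (ƛ (ƛ (tr (≐-context (app f (x0 ∷ x3 ∷ [])) h1)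
                            (≐-context (app f (x2 ∷ x0 ∷ [])) h0))))

cS : Γ ⊩ (s ≐ t) → Γ ⊩ (S s ≐ S t)
cS = cong1 (succ' , succ')
cH : Γ ⊩ (s ≐ t) → Γ ⊩ (½ s ≐ ½ t)
cH = cong1 (half' , half')
cL : Γ ⊩ (s ≐ t) → Γ ⊩ (∣ s ∣ ≐ ∣ t ∣)
cL = cong1 (len' , len')
cF : Γ ⊩ (s ≐ t) → Γ ⊩ (F s ≐ F t)
cF = cong1 Fact
c⊕ : Γ ⊩ (s ≐ s') → Γ ⊩ (t ≐ t') → Γ ⊩ (s ⊕ t ≐ s' ⊕ t')
c⊕ = cong2 (plus' , plus')
c⊗ : Γ ⊩ (s ≐ s') → Γ ⊩ (t ≐ t') → Γ ⊩ (s ⊗ t ≐ s' ⊗ t')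
c⊗ = cong2 (times' , times')
c♯ : Γ ⊩ (s ≐ s') → Γ ⊩ (t ≐ t') → Γ ⊩ (s ♯ t ≐ s' ♯ t')
c♯ = cong2 (smash' , smash')

ax : BASIC φ → (p q r s : Tm n) → Γ ⊩ substF (p ∷ₛ q ∷ₛ r ∷ₛ s ∷ₛ ε) φ
ax B p q r s = thm (basic B (p ∷ₛ q ∷ₛ r ∷ₛ s ∷ₛ ε))

⊕-comm : ∀ p q → Γ ⊩ (p ⊕ q ≐ q ⊕ p)
⊕-comm p q = ax B21 p q Z Z
⊕-identityʳ : ∀ p → Γ ⊩ (p ⊕ Z ≐ p)
⊕-identityʳ p = ax B22 p Z Z Z
⊕-suc : ∀ p q → Γ ⊩ (p ⊕ S q ≐ S (p ⊕ q))
⊕-suc p q = ax B23 p q Z Z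
⊗-zeroʳ : ∀ p → Γ ⊩ (p ⊗ Z ≐ Z)
⊗-zeroʳ p = ax B26 p Z Z Z
⊗-suc : ∀ p q → Γ ⊩ (p ⊗ S q ≐ (p ⊗ q) ⊕ p)
⊗-suc p q = ax B27 p q Z Z
⊗-comm : ∀ p q → Γ ⊩ (p ⊗ q ≐ q ⊗ p)
⊗-comm p q = ax B28 p q Z Z
⊗-distribˡ-⊕ : ∀ p q r → Γ ⊩ (p ⊗ (q ⊕ r) ≐ (p ⊗ q) ⊕ (p ⊗ r))
⊗-distribˡ-⊕ p q r = ax B29 p q r Z

⊕-identityˡ : ∀ p → Γ ⊩ (Z ⊕ p ≐ p)
⊕-identityˡ p = tr (⊕-comm Z p) (⊕-identityʳ p)
suc-⊕ : ∀ p q → Γ ⊩ (S p ⊕ q ≐ S (p ⊕ q))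
suc-⊕ p q = S p ⊕ q ≐⟨ ⊕-comm (S p) q ⟩ q ⊕ S p ≐⟨ ⊕-suc q p ⟩ S (q ⊕ p) ≐⟨ cS (⊕-comm q p) ⟩
            S (p ⊕ q) ∎
⊗-identityʳ : ∀ p → Γ ⊩ (p ⊗ 𝟏 ≐ p)
⊗-identityʳ p = p ⊗ 𝟏 ≐⟨ ⊗-suc p Z ⟩ (p ⊗ Z) ⊕ p ≐⟨ c⊕ (⊗-zeroʳ p) rfl ⟩ Z ⊕ p ≐⟨ ⊕-identityˡ p ⟩
                p ∎
⊗-identityˡ : ∀ p → Γ ⊩ (𝟏 ⊗ p ≐ p)
⊗-identityˡ p = tr (⊗-comm 𝟏 p) (⊗-identityʳ p)
𝟐⊗ : ∀ p → Γ ⊩ (𝟐 ⊗ p ≐ p ⊕ p)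
𝟐⊗ p = 𝟐 ⊗ p ≐⟨ ⊗-comm 𝟐 p ⟩ p ⊗ 𝟐 ≐⟨ ⊗-suc p 𝟏 ⟩ (p ⊗ 𝟏) ⊕ p ≐⟨ c⊕ (⊗-identityʳ p) rfl ⟩
       p ⊕ p ∎
⊕𝟏 : ∀ p → Γ ⊩ (p ⊕ 𝟏 ≐ S p)
⊕𝟏 p = tr (⊕-suc p Z) (cS (⊕-identityʳ p))
𝟏⊕ : ∀ p → Γ ⊩ (𝟏 ⊕ p ≐ S p)
𝟏⊕ p = tr (⊕-comm 𝟏 p) (⊕𝟏 p)
⊗-distribʳ-⊕ : ∀ p q r → Γ ⊩ ((p ⊕ q) ⊗ r ≐ (p ⊗ r) ⊕ (q ⊗ r))
⊗-distribʳ-⊕ p q r =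
  (p ⊕ q) ⊗ r ≐⟨ ⊗-comm (p ⊕ q) r ⟩ r ⊗ (p ⊕ q) ≐⟨ ⊗-distribˡ-⊕ r p q ⟩
  (r ⊗ p) ⊕ (r ⊗ q) ≐⟨ c⊕ (⊗-comm r p) (⊗-comm r q) ⟩ (p ⊗ r) ⊕ (q ⊗ r) ∎

parity : ∀ p → Γ ⊩ ((𝟐 ⊗ ½ p ≐ p) ∨' (S (𝟐 ⊗ ½ p) ≐ p))
parity p = ∧E₁ (ax B32 (½ p) p Z Z) · rfl
½-suc-double : ∀ p → Γ ⊩ (½ (S (p ⊕ p)) ≐ p)
½-suc-double p = symm (∧E₂ (ax B32 p (S (p ⊕ p)) Z Z) · ∨I₂ (cS (𝟐⊗ p)))

≤'-refl : ∀ p → Γ ⊩ (p ≤' p)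
≤'-refl p = cases (p ≤' p) (ƛ h0) (ax B6 p p Z Z)
z≤' : ∀ p → Γ ⊩ (Z ≤' p)
z≤' p = ax B3 p Z Z Z
≤'-step : Γ ⊩ (p ≤' q) → Γ ⊩ (p ≤' S q)
≤'-step {p = p} {q = q} h = ax B1 q p Z Z · h
≤'-trans : Γ ⊩ (p ≤' q) → Γ ⊩ (q ≤' r) → Γ ⊩ (p ≤' r)
≤'-trans {p = p} {q = q} {r = r} h k = ax B8 p q r Z · ∧I h k
≤'-antisym : Γ ⊩ (p ≤' q) → Γ ⊩ (q ≤' p) → Γ ⊩ (p ≐ q)
≤'-antisym {p = p} {q = q} h k = ax B7 p q Z Z · ∧I h k
m≤'m⊕n : ∀ p q → Γ ⊩ (p ≤' p ⊕ q)
m≤'m⊕n p q = ax B19 p q Z Z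

≤'-cong : Γ ⊩ (s ≐ s') → Γ ⊩ (t ≐ t') → Γ ⊩ (s ≤' t) → Γ ⊩ (s' ≤' t')
≤'-cong {s = s} {s' = s'} {t = t} {t' = t'} p q r =
  inst ≤'-cong₀ (s ∷ₛ s' ∷ₛ t ∷ₛ t' ∷ₛ ε) · p · q · r
  where
  ≤'-cong₀ : Thm 4 (x0 ≐ x1 ⇒ x2 ≐ x3 ⇒ x0 ≤' x2 ⇒ x1 ≤' x3)
  ≤'-cong₀ = closed (ƛ (ƛ (ƛ (leibniz (x2 ≤' x0) h1 (leibniz (x0 ≤' x3) h2 h0)))))

≤'-reflexive : Γ ⊩ (s ≐ t) → Γ ⊩ (s ≤' t)
≤'-reflexive {s = s} p = ≤'-cong rfl p (≤'-refl s)

s≤'s⁻¹ : Γ ⊩ (S p ≤' S q) → Γ ⊩ (p ≤' q)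
s≤'s⁻¹ {p = p} {q = q} h = ∧E₁ (ax B25 𝟏 p q Z) · ≤'-cong (symm (𝟏⊕ p)) (symm (𝟏⊕ q)) h

s≤'s : Γ ⊩ (p ≤' q) → Γ ⊩ (S p ≤' S q)
s≤'s {p = p} {q = q} h = ≤'-cong (𝟏⊕ p) (𝟏⊕ q) (∧E₂ (ax B25 𝟏 p q Z) · h)

S-injective : Γ ⊩ (S p ≐ S q) → Γ ⊩ (p ≐ q)
S-injective e = ≤'-antisym (s≤'s⁻¹ (≤'-reflexive e)) (s≤'s⁻¹ (≤'-reflexive (symm e)))

S≢Z : ∀ p → Γ ⊩ (S p ≠ Z)
S≢Z {Γ = Γ} p = ƛ (ax B2 Z Z Z Z · tr (symm h0) (cS p≐Z))
  where
  p≐Z : ((S p ≐ Z) ∷ Γ) ⊩ (p ≐ Z)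
  p≐Z = ≤'-antisym (≤'-cong rfl h0 (≤'-step (≤'-refl p))) (z≤' p)

≢Z⇒𝟏≤' : Γ ⊩ (p ≠ Z) → Γ ⊩ (𝟏 ≤' p)
≢Z⇒𝟏≤' {p = p} h = ∧E₁ (ax B4 Z p Z Z) · ∧I (z≤' p) (ƛ (↑ h · symm h0))

factor≤'product : Γ ⊩ (𝟏 ≤' p) → Γ ⊩ (p ⊗ q ≐ w) → Γ ⊩ (q ≤' w)
factor≤'product {p = p} {q = q} {w = w} hp e =
  cases (q ≐ Z) (ƛ (≤'-cong (symm h0) rfl (z≤' w)))
        (ƛ (≤'-cong (⊗-identityʳ q) (tr (⊗-comm q p) (↑ e))
                    (∧E₂ (ax B30 q 𝟏 p Z · ≢Z⇒𝟏≤' h0) · ↑ hp)))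

𝟏≤'-⊗ : Γ ⊩ (𝟏 ≤' p) → Γ ⊩ (𝟏 ≤' q) → Γ ⊩ (𝟏 ≤' p ⊗ q)
𝟏≤'-⊗ {p = p} {q = q} hp hq = ≤'-trans hp (≤'-cong (⊗-identityʳ p) rfl (∧E₂ (ax B30 p 𝟏 q Z · hp) · hq))

½-≤' : ∀ u → Γ ⊩ (½ u ≤' u)
½-≤' u = ∨E (parity u)
           (ƛ (≤'-cong rfl (tr (symm (𝟐⊗ _)) h0) (m≤'m⊕n _ _)))
           (ƛ (≤'-cong rfl (tr (cS (symm (𝟐⊗ _))) h0) (≤'-step (m≤'m⊕n _ _))))

∣Z∣ : Γ ⊩ (∣ Z ∣ ≐ Z)
∣Z∣ = ax B9 Z Z Z Z

∣∣-unfold : Γ ⊩ (t ≠ Z) → Γ ⊩ (∣ t ∣ ≐ S ∣ ½ t ∣)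
∣∣-unfold {t = t} h = ax B31 t Z Z Z · h

∣zero∣-≤' : Γ ⊩ (t ≐ Z) → Γ ⊩ (s ≤' ∣ t ∣) → Γ ⊩ (s ≐ ∣ t ∣)
∣zero∣-≤' {Γ = Γ} {t = t} t≐Z s≤∣t∣ = tr (≤'-antisym (≤'-cong rfl ∣t∣≐Z s≤∣t∣) (z≤' _)) (symm ∣t∣≐Z)
  where
  ∣t∣≐Z : Γ ⊩ (∣ t ∣ ≐ Z)
  ∣t∣≐Z = tr (cL t≐Z) ∣Z∣

<'∣∣⇒≤'∣½∣ : Γ ⊩ (t ≠ Z) → Γ ⊩ (s ≤' ∣ t ∣) → Γ ⊩ (s ≠ ∣ t ∣) → Γ ⊩ (s ≤' ∣ ½ t ∣)
<'∣∣⇒≤'∣½∣ {t = t} {s = s} t≢Z s≤∣t∣ s≢∣t∣ =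
  s≤'s⁻¹ (≤'-cong rfl (∣∣-unfold t≢Z) (∧E₁ (ax B4 s ∣ t ∣ Z Z) · ∧I s≤∣t∣ s≢∣t∣))

∣½∣≤'∣∣ : Γ ⊩ (t ≠ Z) → Γ ⊩ (∣ ½ t ∣ ≤' ∣ t ∣)
∣½∣≤'∣∣ t≢Z = ≤'-cong rfl (symm (∣∣-unfold t≢Z)) (≤'-step (≤'-refl _))

∣suc-double∣ : ∀ p → Γ ⊩ (∣ S (p ⊕ p) ∣ ≐ S ∣ p ∣)
∣suc-double∣ p = tr (∣∣-unfold (S≢Z _)) (cS (cL (½-suc-double p)))

-- BASIC lacks associativity of multiplication; it takes an induction on the last factor.
⊗-assoc : ∀ p q r → Γ ⊩ ((p ⊗ q) ⊗ r ≐ p ⊗ (q ⊗ r))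
⊗-assoc p q r = inst ⊗-assoc₀ (r ∷ₛ p ∷ₛ q ∷ₛ ε)
  where
  IH : Fm 3
  IH = (x1 ⊗ x2) ⊗ ½ x0 ≐ x1 ⊗ (x2 ⊗ ½ x0)
  doubled : Γ ⊩ IH → Γ ⊩ ((x1 ⊗ x2) ⊗ (½ x0 ⊕ ½ x0) ≐ x1 ⊗ (x2 ⊗ (½ x0 ⊕ ½ x0)))
  doubled ih =
    (x1 ⊗ x2) ⊗ (½ x0 ⊕ ½ x0)                    ≐⟨ ⊗-distribˡ-⊕ _ _ _ ⟩
    ((x1 ⊗ x2) ⊗ ½ x0) ⊕ ((x1 ⊗ x2) ⊗ ½ x0)      ≐⟨ c⊕ ih ih ⟩
    (x1 ⊗ (x2 ⊗ ½ x0)) ⊕ (x1 ⊗ (x2 ⊗ ½ x0))      ≐⟨ symm (⊗-distribˡ-⊕ _ _ _) ⟩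
    x1 ⊗ ((x2 ⊗ ½ x0) ⊕ (x2 ⊗ ½ x0))            ≐⟨ c⊗ rfl (symm (⊗-distribˡ-⊕ _ _ _)) ⟩
    x1 ⊗ (x2 ⊗ (½ x0 ⊕ ½ x0)) ∎
  even : ((𝟐 ⊗ ½ x0 ≐ x0) ∷ IH ∷ []) ⊩ ((x1 ⊗ x2) ⊗ x0 ≐ x1 ⊗ (x2 ⊗ x0))
  even = tr (c⊗ rfl (symm x0≐2h)) (tr (doubled h1) (c⊗ rfl (c⊗ rfl x0≐2h)))
    where
    x0≐2h : ((𝟐 ⊗ ½ x0 ≐ x0) ∷ IH ∷ []) ⊩ (½ x0 ⊕ ½ x0 ≐ x0)
    x0≐2h = tr (symm (𝟐⊗ _)) h0
  odd : ((S (𝟐 ⊗ ½ x0) ≐ x0) ∷ IH ∷ []) ⊩ ((x1 ⊗ x2) ⊗ x0 ≐ x1 ⊗ (x2 ⊗ x0))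
  odd = (x1 ⊗ x2) ⊗ x0                          ≐⟨ c⊗ rfl (symm x0≐2h+1) ⟩
        (x1 ⊗ x2) ⊗ S (½ x0 ⊕ ½ x0)              ≐⟨ ⊗-suc _ _ ⟩
        ((x1 ⊗ x2) ⊗ (½ x0 ⊕ ½ x0)) ⊕ (x1 ⊗ x2)  ≐⟨ c⊕ (doubled h1) rfl ⟩
        (x1 ⊗ (x2 ⊗ (½ x0 ⊕ ½ x0))) ⊕ (x1 ⊗ x2)  ≐⟨ symm (⊗-distribˡ-⊕ _ _ _) ⟩
        x1 ⊗ ((x2 ⊗ (½ x0 ⊕ ½ x0)) ⊕ x2)        ≐⟨ c⊗ rfl (symm (⊗-suc _ _)) ⟩
        x1 ⊗ (x2 ⊗ S (½ x0 ⊕ ½ x0))              ≐⟨ c⊗ rfl (c⊗ rfl x0≐2h+1) ⟩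
        x1 ⊗ (x2 ⊗ x0) ∎
    where
    x0≐2h+1 : ((S (𝟐 ⊗ ½ x0) ≐ x0) ∷ IH ∷ []) ⊩ (S (½ x0 ⊕ ½ x0) ≐ x0)
    x0≐2h+1 = tr (cS (symm (𝟐⊗ _))) h0
  ⊗-assoc₀ : Thm 3 ((x1 ⊗ x2) ⊗ x0 ≐ x1 ⊗ (x2 ⊗ x0))
  ⊗-assoc₀ = pind-open _ (base (eq _ _)) start (∨E (parity x0) (ƛ even) (ƛ odd))
    where
    start : [] ⊩ ((x0 ⊗ x1) ⊗ Z ≐ x0 ⊗ (x1 ⊗ Z))
    start = tr (⊗-zeroʳ _) (symm (tr (c⊗ rfl (⊗-zeroʳ x1)) (⊗-zeroʳ x0)))

xy∙z≐y∙xz : ∀ p q r → Γ ⊩ ((p ⊗ q) ⊗ r ≐ q ⊗ (p ⊗ r))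
xy∙z≐y∙xz p q r = tr (c⊗ (⊗-comm p q) rfl) (⊗-assoc q p r)

x∙yz≐z∙xy : ∀ p q r → Γ ⊩ (p ⊗ (q ⊗ r) ≐ r ⊗ (p ⊗ q))
x∙yz≐z∙xy p q r = tr (symm (⊗-assoc p q r)) (⊗-comm (p ⊗ q) r)

Fact-zero : Γ ⊩ (F Z ≐ 𝟏)
Fact-zero = tr (thm (def-lrn0 _ _ _ _ [])) (tr (thm (def-comp _ _ [])) (cS (thm (def-comp _ _ []))))

Fact-unfold : Γ ⊩ (t ≠ Z) → Γ ⊩ (F t ≐ F (½ t) ⊗ ∣ t ∣)
Fact-unfold {t = t} h =
  tr (thm (def-lrn1 _ _ _ _ t []) · h)
     (tr (thm (def-comp _ _ _))
         (c⊗ (thm (def-proj _ _)) (tr (thm (def-comp _ _ _)) (cL (thm (def-proj _ _))))))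

appendOnes-zero : Γ ⊩ (appendOnes Z t ≐ t)
appendOnes-zero {t = t} = tr (thm (def-lrn0 _ _ _ _ (t ∷ []))) (thm (def-proj zero (t ∷ [])))

appendOnes-unfold : Γ ⊩ (v ≠ Z) →
                    Γ ⊩ (appendOnes v t ≐ S (appendOnes (½ v) t ⊕ appendOnes (½ v) t))
appendOnes-unfold {v = v} {t = t} h =
  tr (thm (def-lrn1 _ _ _ _ v (t ∷ [])) · h)
     (tr (thm (def-comp _ _ _))
         (cS (tr (thm (def-comp _ _ _)) (c⊕ (thm (def-proj _ _)) (thm (def-proj _ _))))))

½-appendOnes : Γ ⊩ (v ≠ Z) → Γ ⊩ (½ (appendOnes v t) ≐ appendOnes (½ v) t)
½-appendOnes h = tr (cH (appendOnes-unfold h)) (½-suc-double _)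

appendOnes≢Z : Γ ⊩ (v ≠ Z) → Γ ⊩ (appendOnes v t ≠ Z)
appendOnes≢Z h = ƛ (S≢Z _ · tr (symm (↑ (appendOnes-unfold h))) h0)

∣appendOnes∣ : Γ ⊩ (∣ appendOnes v t ∣ ≐ ∣ v ∣ ⊕ ∣ t ∣)
∣appendOnes∣ {v = v} {t = t} = inst (pind-≢Z Len (base (eq _ _)) start step) (v ∷ₛ t ∷ₛ ε)
  where
  Len : Fm 2
  Len = ∣ appendOnes x0 x1 ∣ ≐ ∣ x0 ∣ ⊕ ∣ x1 ∣
  start : [] ⊩ (Len [ Z ])
  start = tr (cL appendOnes-zero) (symm (tr (c⊕ ∣Z∣ rfl) (⊕-identityˡ _)))
  step : ((x0 ≠ Z) ∷ substF subHalf Len ∷ []) ⊩ Len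
  step = ∣ appendOnes x0 x1 ∣                ≐⟨ cL (appendOnes-unfold h0) ⟩
         ∣ S (half ⊕ half) ∣                 ≐⟨ ∣suc-double∣ half ⟩
         S ∣ half ∣                           ≐⟨ cS h1 ⟩
         S (∣ ½ x0 ∣ ⊕ ∣ x1 ∣)               ≐⟨ symm (suc-⊕ _ _) ⟩
         S ∣ ½ x0 ∣ ⊕ ∣ x1 ∣                 ≐⟨ c⊕ (symm (∣∣-unfold h0)) rfl ⟩
         ∣ x0 ∣ ⊕ ∣ x1 ∣ ∎
    where
    half : Tm 2
    half = appendOnes (½ x0) x1

𝟏♯Z : Γ ⊩ (𝟏 ♯ Z ≐ 𝟏)
𝟏♯Z = tr (ax B16 𝟏 Z Z Z) (ax B14 𝟏 Z Z Z)

-- BASIC only pins 1 # 1 down through the equation X · X = 2 · X, which B30 cancels.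
𝟏♯𝟏 : Γ ⊩ (𝟏 ♯ 𝟏 ≐ 𝟐)
𝟏♯𝟏 = ≤'-antisym (∧E₁ (ax B30 X X 𝟐 Z · 𝟏≤'X) · ≤'-reflexive (tr square (⊗-comm 𝟐 X)))
                 (∧E₁ (ax B30 X 𝟐 X Z · 𝟏≤'X) · ≤'-reflexive (tr (⊗-comm X 𝟐) (symm square)))
  where
  X : ∀ {m} → Tm m
  X = 𝟏 ♯ 𝟏
  ∣𝟐⊗𝟏∣ : Γ ⊩ (∣ 𝟐 ⊗ 𝟏 ∣ ≐ ∣ 𝟏 ∣ ⊕ ∣ 𝟏 ∣)
  ∣𝟐⊗𝟏∣ = tr (∧E₁ (ax B10 𝟏 Z Z Z · S≢Z Z)) (tr (symm (⊕𝟏 _)) (c⊕ rfl (symm (ax B11 Z Z Z Z))))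
  square : Γ ⊩ (X ⊗ X ≐ 𝟐 ⊗ X)
  square = X ⊗ X            ≐⟨ symm (ax B18 (𝟐 ⊗ 𝟏) 𝟏 𝟏 𝟏 · ∣𝟐⊗𝟏∣) ⟩
           (𝟐 ⊗ 𝟏) ♯ 𝟏      ≐⟨ symm (ax B16 𝟏 (𝟐 ⊗ 𝟏) Z Z) ⟩
           𝟏 ♯ (𝟐 ⊗ 𝟏)      ≐⟨ ∧E₁ (ax B15 𝟏 Z Z Z · S≢Z Z) ⟩
           𝟐 ⊗ X ∎
  𝟏≤'X : Γ ⊩ (𝟏 ≤' X)
  𝟏≤'X = ≢Z⇒𝟏≤' (ƛ (S≢Z (∣ 𝟏 ∣ ⊗ ∣ 𝟏 ∣) · tr (symm (ax B13 𝟏 𝟏 Z Z)) (tr (cL h0) ∣Z∣)))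

𝟏♯-double : {Γ : List (Fm n)} → Γ ⊩ (v ≠ Z) → Γ ⊩ (𝟏 ♯ v ≐ (𝟏 ♯ ½ v) ⊕ (𝟏 ♯ ½ v))
𝟏♯-double {n = n} {v = v} {Γ = Γ} v≢Z = cases (½ v ≐ Z) (ƛ half-zero) (ƛ half-nonzero)
  where
  P : Tm n
  P = 𝟏 ♯ ½ v
  half-zero : ((½ v ≐ Z) ∷ Γ) ⊩ (𝟏 ♯ v ≐ P ⊕ P)
  half-zero = ∨E (parity v)
    (ƛ (absurd (tr (symm h0) (tr (c⊗ rfl h1) (⊗-zeroʳ 𝟐))) (↑ (↑ v≢Z))))
    (ƛ (𝟏 ♯ v        ≐⟨ c♯ rfl (tr (symm h0) (cS (tr (c⊗ rfl h1) (⊗-zeroʳ 𝟐)))) ⟩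
        𝟏 ♯ 𝟏        ≐⟨ 𝟏♯𝟏 ⟩
        𝟐            ≐⟨ symm (𝟏⊕ 𝟏) ⟩
        𝟏 ⊕ 𝟏        ≐⟨ symm (c⊕ (tr (c♯ rfl h1) 𝟏♯Z) (tr (c♯ rfl h1) 𝟏♯Z)) ⟩
        P ⊕ P ∎))
  half-nonzero : (¬' (½ v ≐ Z) ∷ Γ) ⊩ (𝟏 ♯ v ≐ P ⊕ P)
  half-nonzero = ∨E (parity v)
    (ƛ (tr (c♯ rfl (symm h0)) (tr (∧E₁ (ax B15 (½ v) Z Z Z · h1)) (𝟐⊗ P))))
    (ƛ (tr (c♯ rfl (symm h0)) (tr (∧E₂ (ax B15 (½ v) Z Z Z · h1)) (𝟐⊗ P))))

suc-appendOnes : Γ ⊩ (S (appendOnes v t) ≐ S t ⊗ (𝟏 ♯ v))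
suc-appendOnes {v = v} {t = t} = inst (pind-≢Z Succ (base (eq _ _)) start step) (v ∷ₛ t ∷ₛ ε)
  where
  Succ : Fm 2
  Succ = S (appendOnes x0 x1) ≐ S x1 ⊗ (𝟏 ♯ x0)
  start : [] ⊩ (Succ [ Z ])
  start = tr (cS appendOnes-zero) (symm (tr (c⊗ rfl 𝟏♯Z) (⊗-identityʳ _)))
  step : ((x0 ≠ Z) ∷ substF subHalf Succ ∷ []) ⊩ Succ
  step = S (appendOnes x0 x1)                ≐⟨ cS (appendOnes-unfold h0) ⟩
         S (S (half ⊕ half))                 ≐⟨ cS (symm (suc-⊕ half half)) ⟩
         S (S half ⊕ half)                   ≐⟨ symm (⊕-suc (S half) half) ⟩
         S half ⊕ S half                     ≐⟨ c⊕ h1 h1 ⟩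
         (S x1 ⊗ P) ⊕ (S x1 ⊗ P)             ≐⟨ symm (⊗-distribˡ-⊕ _ _ _) ⟩
         S x1 ⊗ (P ⊕ P)                      ≐⟨ c⊗ rfl (symm (𝟏♯-double h0)) ⟩
         S x1 ⊗ (𝟏 ♯ x0) ∎
    where
    half P : Tm 2
    half = appendOnes (½ x0) x1
    P = 𝟏 ♯ ½ x0

Fact-appendOnes-Z : Γ ⊩ (F t ≐ F (appendOnes t Z))
Fact-appendOnes-Z {t = t} =
  inst (pind-≢Z Ones (base (eq _ _)) (cF (symm appendOnes-zero)) step) (t ∷ₛ ε)
  where
  Ones : Fm 1
  Ones = F x0 ≐ F (appendOnes x0 Z)
  step : ((x0 ≠ Z) ∷ substF subHalf Ones ∷ []) ⊩ Ones
  step = F x0                                          ≐⟨ Fact-unfold h0 ⟩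
         F (½ x0) ⊗ ∣ x0 ∣                             ≐⟨ c⊗ h1 (symm ∣ones∣) ⟩
         F (appendOnes (½ x0) Z) ⊗ ∣ appendOnes x0 Z ∣  ≐⟨ c⊗ (cF (symm (½-appendOnes h0))) rfl ⟩
         F (½ (appendOnes x0 Z)) ⊗ ∣ appendOnes x0 Z ∣  ≐⟨ symm (Fact-unfold (appendOnes≢Z h0)) ⟩
         F (appendOnes x0 Z) ∎
    where
    ∣ones∣ : ((x0 ≠ Z) ∷ substF subHalf Ones ∷ []) ⊩ (∣ appendOnes x0 Z ∣ ≐ ∣ x0 ∣)
    ∣ones∣ = tr ∣appendOnes∣ (tr (c⊕ rfl ∣Z∣) (⊕-identityʳ _))

-- Both sides equal Fact of the all-ones number of that length, which is fixed by 1 # s = 1 # t.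
Fact-cong-∣∣ : Γ ⊩ (∣ s ∣ ≐ ∣ t ∣) → Γ ⊩ (F s ≐ F t)
Fact-cong-∣∣ {Γ = Γ} {s = s} {t = t} h =
  tr Fact-appendOnes-Z (tr (cF (S-injective same-successor)) (symm Fact-appendOnes-Z))
  where
  𝟏♯s≐𝟏♯t : Γ ⊩ (𝟏 ♯ s ≐ 𝟏 ♯ t)
  𝟏♯s≐𝟏♯t = tr (ax B16 𝟏 s Z Z) (tr (ax B17 s t 𝟏 Z · h) (ax B16 t 𝟏 Z Z))
  same-successor : Γ ⊩ (S (appendOnes s Z) ≐ S (appendOnes t Z))
  same-successor = tr suc-appendOnes (tr (c⊗ rfl 𝟏♯s≐𝟏♯t) (symm suc-appendOnes))

𝟏≤'Fact : Γ ⊩ (𝟏 ≤' F t)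
𝟏≤'Fact {t = t} = inst (pind-≢Z (𝟏 ≤' F x0) (base (le _ _)) start step) (t ∷ₛ ε)
  where
  start : [] ⊩ (𝟏 ≤' F Z)
  start = ≤'-cong rfl (symm Fact-zero) (≤'-refl 𝟏)
  step : ((x0 ≠ Z) ∷ (𝟏 ≤' F (½ x0)) ∷ []) ⊩ (𝟏 ≤' F x0)
  step = ≤'-cong rfl (symm (Fact-unfold h0)) (𝟏≤'-⊗ h1 𝟏≤'∣x0∣)
    where
    𝟏≤'∣x0∣ : ((x0 ≠ Z) ∷ (𝟏 ≤' F (½ x0)) ∷ []) ⊩ (𝟏 ≤' ∣ x0 ∣)
    𝟏≤'∣x0∣ = ≤'-cong rfl (symm (∣∣-unfold h0)) (s≤'s (z≤' _))

Divides-intro : (q : Tm n) → Γ ⊩ (q ≤' t) → Γ ⊩ (s ⊗ q ≐ t) → Γ ⊩ Divides s t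
Divides-intro {Γ = Γ} {t = t} {s = s} q q≤t e =
  ∃≤I q q≤t (subst₂ (λ a b → Γ ⊩ (a ⊗ q ≐ b)) (sym (sub0-wkT q s)) (sym (sub0-wkT q t)) e)

Divides-cong : Γ ⊩ (s ≐ s') → Γ ⊩ (t ≐ t') → Γ ⊩ Divides s t → Γ ⊩ Divides s' t'
Divides-cong {s = s} {s' = s'} {t = t} {t' = t'} p q d =
  inst Divides-cong₀ (s ∷ₛ s' ∷ₛ t ∷ₛ t' ∷ₛ ε) · p · q · d
  where
  Divides-cong₀ : Thm 4 (x0 ≐ x1 ⇒ x2 ≐ x3 ⇒ Divides x0 x2 ⇒ Divides x1 x3)
  Divides-cong₀ =
    closed (ƛ (ƛ (ƛ (∃≤E h0 (∃≤I x0 (≤'-cong rfl h3 h1) (tr (c⊗ (symm h4) rfl) (tr h0 h3)))))))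

Binom : Tm n → Tm n → Fm n
Binom z v = Divides (F z ⊗ F v) (F (appendOnes v z))

Binom-Σb1 : Σb1 (Binom z v)
Binom-Σb1 {z = z} {v = v} = ex≤ (F (appendOnes v z)) (base (eq _ _))

Binom-intro : (q : Tm n) → Γ ⊩ ((F z ⊗ F v) ⊗ q ≐ F (appendOnes v z)) → Γ ⊩ Binom z v
Binom-intro q e = Divides-intro q (factor≤'product (𝟏≤'-⊗ 𝟏≤'Fact 𝟏≤'Fact) e) e

Binom-cong-∣∣ : Γ ⊩ (∣ s ∣ ≐ ∣ t ∣) → Γ ⊩ Binom s v → Γ ⊩ Binom t v
Binom-cong-∣∣ {t = t} {v = v} h =
  Divides-cong {s' = F t ⊗ F v} {t' = F (appendOnes v t)} (c⊗ (Fact-cong-∣∣ h) rfl)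
               (Fact-cong-∣∣ (tr ∣appendOnes∣ (tr (c⊕ rfl h) (symm ∣appendOnes∣))))

Binom-zeroˡ : Γ ⊩ (z ≐ Z) → Γ ⊩ Binom z v
Binom-zeroˡ {z = z} {v = v} h = Binom-intro 𝟏
  ((F z ⊗ F v) ⊗ 𝟏 ≐⟨ ⊗-identityʳ _ ⟩ F z ⊗ F v ≐⟨ c⊗ (tr (cF h) Fact-zero) rfl ⟩
   𝟏 ⊗ F v ≐⟨ ⊗-identityˡ _ ⟩ F v ≐⟨ Fact-appendOnes-Z ⟩
   F (appendOnes v Z) ≐⟨ cF (cong2 AppendOnes rfl (symm h)) ⟩ F (appendOnes v z) ∎)

Binom-zeroʳ : Γ ⊩ (v ≐ Z) → Γ ⊩ Binom z v
Binom-zeroʳ {v = v} {z = z} h = Binom-intro 𝟏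
  ((F z ⊗ F v) ⊗ 𝟏 ≐⟨ ⊗-identityʳ _ ⟩ F z ⊗ F v ≐⟨ c⊗ rfl (tr (cF h) Fact-zero) ⟩
   F z ⊗ 𝟏 ≐⟨ ⊗-identityʳ _ ⟩ F z ≐⟨ cF (symm appendOnes-zero) ⟩
   F (appendOnes Z z) ≐⟨ cF (cong2 AppendOnes (symm h) rfl) ⟩ F (appendOnes v z) ∎)

Fact-pascal : ∀ {n} {Γ : List (Fm n)} {z v q r : Tm n} → Γ ⊩ (z ≠ Z) → Γ ⊩ (v ≠ Z) →
              Γ ⊩ ((F (½ z) ⊗ F v) ⊗ q ≐ F (appendOnes v (½ z))) →
              Γ ⊩ ((F z ⊗ F (½ v)) ⊗ r ≐ F (appendOnes (½ v) z)) →
              Γ ⊩ ((F z ⊗ F v) ⊗ (q ⊕ r) ≐ F (appendOnes v z))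
Fact-pascal {n = n} {Γ = Γ} {z = z} {v = v} {q = q} {r = r} z≢Z v≢Z quotient-q quotient-r =
  (F z ⊗ F v) ⊗ (q ⊕ r)                  ≐⟨ ⊗-distribˡ-⊕ _ _ _ ⟩
  ((F z ⊗ F v) ⊗ q) ⊕ ((F z ⊗ F v) ⊗ r)  ≐⟨ c⊕ part-q part-r ⟩
  (∣ z ∣ ⊗ Fpred) ⊕ (∣ v ∣ ⊗ Fpred)      ≐⟨ symm (⊗-distribʳ-⊕ _ _ _) ⟩
  (∣ z ∣ ⊕ ∣ v ∣) ⊗ Fpred                ≐⟨ ⊗-comm _ _ ⟩
  Fpred ⊗ (∣ z ∣ ⊕ ∣ v ∣)                ≐⟨ c⊗ rfl (tr (⊕-comm _ _) (symm ∣appendOnes∣)) ⟩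
  Fpred ⊗ ∣ appendOnes v z ∣             ≐⟨ symm (Fact-unfold (appendOnes≢Z v≢Z)) ⟩
  F (appendOnes v z) ∎
  where
  Fpred : Tm n
  Fpred = F (½ (appendOnes v z))
  ∣appendOnes-v-½z∣ : Γ ⊩ (∣ appendOnes v (½ z) ∣ ≐ ∣ ½ (appendOnes v z) ∣)
  ∣appendOnes-v-½z∣ = S-injective
    (S ∣ appendOnes v (½ z) ∣     ≐⟨ cS ∣appendOnes∣ ⟩
     S (∣ v ∣ ⊕ ∣ ½ z ∣)          ≐⟨ symm (⊕-suc _ _) ⟩
     ∣ v ∣ ⊕ S ∣ ½ z ∣            ≐⟨ c⊕ rfl (symm (∣∣-unfold z≢Z)) ⟩
     ∣ v ∣ ⊕ ∣ z ∣                ≐⟨ symm ∣appendOnes∣ ⟩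
     ∣ appendOnes v z ∣           ≐⟨ ∣∣-unfold (appendOnes≢Z v≢Z) ⟩
     S ∣ ½ (appendOnes v z) ∣ ∎)
  part-q : Γ ⊩ ((F z ⊗ F v) ⊗ q ≐ ∣ z ∣ ⊗ Fpred)
  part-q = (F z ⊗ F v) ⊗ q                 ≐⟨ c⊗ (c⊗ (Fact-unfold z≢Z) rfl) rfl ⟩
           ((F (½ z) ⊗ ∣ z ∣) ⊗ F v) ⊗ q    ≐⟨ c⊗ (xy∙z≐y∙xz _ _ _) rfl ⟩
           (∣ z ∣ ⊗ (F (½ z) ⊗ F v)) ⊗ q    ≐⟨ ⊗-assoc _ _ _ ⟩
           ∣ z ∣ ⊗ ((F (½ z) ⊗ F v) ⊗ q)    ≐⟨ c⊗ rfl (tr quotient-q (Fact-cong-∣∣ ∣appendOnes-v-½z∣)) ⟩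
           ∣ z ∣ ⊗ Fpred ∎
  part-r : Γ ⊩ ((F z ⊗ F v) ⊗ r ≐ ∣ v ∣ ⊗ Fpred)
  part-r = (F z ⊗ F v) ⊗ r                 ≐⟨ c⊗ (c⊗ rfl (Fact-unfold v≢Z)) rfl ⟩
           (F z ⊗ (F (½ v) ⊗ ∣ v ∣)) ⊗ r    ≐⟨ c⊗ (x∙yz≐z∙xy _ _ _) rfl ⟩
           (∣ v ∣ ⊗ (F z ⊗ F (½ v))) ⊗ r    ≐⟨ ⊗-assoc _ _ _ ⟩
           ∣ v ∣ ⊗ ((F z ⊗ F (½ v)) ⊗ r)    ≐⟨ c⊗ rfl (tr quotient-r (cF (symm (½-appendOnes v≢Z)))) ⟩
           ∣ v ∣ ⊗ Fpred ∎

Binom-step : Thm 2 (x0 ≠ Z ⇒ x1 ≠ Z ⇒ Binom (½ x0) x1 ⇒ Binom x0 (½ x1) ⇒ Binom x0 x1)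
Binom-step = closed (ƛ (ƛ (ƛ (ƛ
  (∃≤E {t = F (appendOnes x1 (½ x0))} h1 (∃≤E {t = F (appendOnes (½ x2) x1)} h2
    (Binom-intro (x1 ⊕ x0) (Fact-pascal h7 h6 h2 h0))))))))

-- PrefixOfEachLength u: every j ≤ ∣u∣ is the length of some z ≤ u (u = x0).
PrefixOfEachLength : Fm 1
PrefixOfEachLength = ∀≤ ∣ x0 ∣ (∃≤ x1 (∣ x0 ∣ ≐ x1))

-- For j < ∣u∣ we have j ≤ ∣½ u∣, and a witness for ½ u also serves u.
prefix-of-each-length : Thm 1 PrefixOfEachLength
prefix-of-each-length = pind-open _ (all|| x0 (ex≤ x1 (base (eq _ _)))) start step
  where
  start : [] ⊩ (PrefixOfEachLength [ Z ])
  start = ∀≤I {t = ∣ Z ∣} (∃≤I {t = Z} Z (≤'-refl Z) (symm (∣zero∣-≤' rfl h0)))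
  step : (substF subHalf PrefixOfEachLength ∷ []) ⊩ PrefixOfEachLength
  step = ∀≤I {t = ∣ x0 ∣} (cases (x0 ≐ ∣ x1 ∣)
    (ƛ (∃≤I {t = x1} x1 (≤'-refl x1) (symm h0)))
    (ƛ (cases (x1 ≐ Z)
      (ƛ (absurd (∣zero∣-≤' h0 h2) h1))
      (ƛ (∃≤E {t = ½ x1} (∀≤E {t = ∣ ½ x1 ∣} h3 x0 (<'∣∣⇒≤'∣½∣ h0 h2 h1))
                         (∃≤I {t = x2} x0 (≤'-trans h1 (½-≤' x2)) h0))))))

-- BinomRow v u (v = x0, u = x1): for each length j ≤ ∣u∣ some z ≤ u of length j has Binom z v.
BinomRow : Fm 2
BinomRow = ∀≤ ∣ x1 ∣ (∃≤ x2 ((∣ x0 ∣ ≐ x1) ∧' Binom x0 x2))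

-- BinomIfShort z v u (z = x0, v = x1, u = x2): ∣z∣ ≤ ∣u∣ implies Binom z v, as a Σ^b_1 disjunction.
BinomIfShort : Fm 3
BinomIfShort = ¬' (∣ x0 ∣ ≤' ∣ x2 ∣) ∨' Binom x0 x1

BinomRow-intro : Thm 2 (∀' BinomIfShort ⇒ BinomRow)
BinomRow-intro = closed (ƛ (∀≤I {t = ∣ x1 ∣}
  (∃≤E {t = x2} (∀≤E {t = ∣ x2 ∣} (inst prefix-of-each-length (x2 ∷ₛ ε)) x0 h0)
    (∃≤I {t = x3} x0 h1 (∧I h0 (∀E h3 x0 · ƛ (h0 · ↑ (≤'-cong (symm h0) rfl h2))))))))

-- Inner induction on z, for fixed v ≠ 0 and u: Binom z (½ v) comes from the row of ½ v.
BinomIfShort-all : Thm 2 (substF subHalf BinomRow ⇒ x0 ≠ Z ⇒ ∀' BinomIfShort)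
BinomIfShort-all = closed (ƛ (ƛ (induction BinomIfShort (or (base (imp (le _ _) bot)) Binom-Σb1)
                                            (∨I₂ (Binom-zeroˡ rfl)) (ƛ (ƛ step)))))
  where
  Hyps : List (Fm 3)
  Hyps = ¬' (¬' (∣ x0 ∣ ≤' ∣ x2 ∣)) ∷ substF subHalf BinomIfShort ∷
         wkF (x0 ≠ Z) ∷ wkF (substF subHalf BinomRow) ∷ []
  nonzero : ((x0 ≠ Z) ∷ Hyps) ⊩ Binom x0 x1
  nonzero = inst Binom-step (x0 ∷ₛ x1 ∷ₛ ε) · h0 · h3 · (h2 · ƛ (h0 · ↑ ∣½z∣≤∣u∣)) · Binom-z-½v
    where
    ∣z∣≤∣u∣ : ((x0 ≠ Z) ∷ Hyps) ⊩ (∣ x0 ∣ ≤' ∣ x2 ∣)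
    ∣z∣≤∣u∣ = dne h1
    ∣½z∣≤∣u∣ : ((x0 ≠ Z) ∷ Hyps) ⊩ (∣ ½ x0 ∣ ≤' ∣ x2 ∣)
    ∣½z∣≤∣u∣ = ≤'-trans (∣½∣≤'∣∣ h0) ∣z∣≤∣u∣
    Binom-z-½v : ((x0 ≠ Z) ∷ Hyps) ⊩ Binom x0 (½ x1)
    Binom-z-½v = ∃≤E {t = x2} (∀≤E {t = ∣ x2 ∣} h4 ∣ x0 ∣ ∣z∣≤∣u∣)
                                 (Binom-cong-∣∣ {v = ½ x2} (∧E₁ h0) (∧E₂ h0))
  step : Hyps ⊩ Binom x0 x1
  step = cases (x0 ≐ Z) (ƛ (Binom-zeroˡ h0)) (ƛ nonzero)

BinomRow-all : Thm 2 BinomRow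
BinomRow-all = pind-≢Z BinomRow (all|| x1 (ex≤ x2 (and (base (eq _ _)) Binom-Σb1))) start step
  where
  start : [] ⊩ (BinomRow [ Z ])
  start = inst BinomRow-intro (Z ∷ₛ x0 ∷ₛ ε) · ∀I (∨I₂ (Binom-zeroʳ rfl))
  step : ((x0 ≠ Z) ∷ substF subHalf BinomRow ∷ []) ⊩ BinomRow
  step = inst BinomRow-intro (x0 ∷ₛ x1 ∷ₛ ε) · (thm BinomIfShort-all · h1 · h0)

Binom-self : Thm 1 (Binom x0 x0)
Binom-self = closed (∃≤E {t = x0} (∀≤E {t = ∣ x0 ∣} (inst BinomRow-all (x0 ∷ₛ x0 ∷ₛ ε)) ∣ x0 ∣ (≤'-refl _))
                         (Binom-cong-∣∣ (∧E₁ h0) (∧E₂ h0)))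

appendOnes-ones : Γ ⊩ IsOnes t → Γ ⊩ (appendOnes t t ≐ ones2 t)
appendOnes-ones {t = t} h = S-injective
  (S (appendOnes t t)        ≐⟨ suc-appendOnes ⟩
   S t ⊗ (𝟏 ♯ t)             ≐⟨ c⊗ rfl (tr (symm h) (⊕𝟏 t)) ⟩
   S t ⊗ S t                 ≐⟨ ⊗-suc _ _ ⟩
   (S t ⊗ t) ⊕ S t           ≐⟨ ⊕-suc _ _ ⟩
   S ((S t ⊗ t) ⊕ t)         ≐⟨ cS (c⊕ (tr (⊗-comm _ _) (⊗-suc _ _)) rfl) ⟩
   S (ones2 t) ∎)

lemma5p13 : S¹₂⊢ FactSquareDiv
lemma5p13 = closed (∀I (ƛ (Divides-cong {s' = F x0 ⊗ F x0} {t' = F (ones2 x0)}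
                              rfl (cF (appendOnes-ones h0)) (thm Binom-self))))
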